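{- Let $q$ be a prime power and $n\ge 1$ an integer such that $n+1$ is a prime and $q$ is a primitive root modulo $n+1$, and let $N$ be the type I optimal normal basis of $\mathbb{F}_{q^n}$ over $\mathbb{F}_q$. Then the complexity of the dual basis of $N$ is $3n-3$ when $q$ is even, and $3n-2$ when $q$ is odd.
   Context: A normal basis of $\mathbb{F}_{q^n}$ over $\mathbb{F}_q$ is a basis of the form $\{\alpha,\alpha^q,\ldots,\alpha^{q^{n-1}}\}$; writing $\alpha_i=\alpha^{q^i}$, define $t_{ij}\in\mathbb{F}_q$ by $\alpha\cdot\alpha_i=\sum_{j=0}^{n-1}t_{ij}\alpha_j$ for $0\le i\le n-1$; the complexity of the normal basis is the number of nonzero entries of the $n\times n$ matrix $(t_{ij})$. The dual basis of a basis $\{\beta_1,\ldots,\beta_n\}$ of $\mathbb{F}_{q^n}$ over $\mathbb{F}_q$ is the basis $\{\beta_1^*,\ldots,\beta_n^*\}$ with $\mathrm{Tr}_{\mathbb{F}_{q^n}/\mathbb{F}_q}(\beta_i\beta_j^*)=\delta_{ij}$ for all $1\le i,j\le n$; the dual of a normal basis is again a normal basis. When $n+1$ is prime and $q$ is primitive modulo $n+1$, the type I optimal normal basis of $\mathbb{F}_{q^n}$ over $\mathbb{F}_q$ is the set $\{\alpha,\alpha^2,\ldots,\alpha^n\}$ of all $(n+1)$-th roots of unity different from $1$ (here $\alpha$ is any $(n+1)$-th root of unity $\neq 1$); it equals $\{\alpha,\alpha^q,\ldots,\alpha^{q^{n-1}}\}$ and is a normal basis. -}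

module Defs where

open import Level using (Level; _⊔_)
open import Algebra.Bundles using (CommutativeRing; Semiring)
open import Data.Nat as ℕ using (ℕ; zero; suc; _≤_; _<_; _∸_; _%_)
open import Data.Nat.Divisibility using (_∣_)
open import Data.Nat.Primality using (Prime)
open import Data.Fin using (Fin; toℕ)
open import Data.Product using (Σ; ∃; _×_; _,_)
open import Relation.Binary.PropositionalEquality using (_≡_; _≢_)
open import Relation.Binary.Definitions using (Decidable)
open import Relation.Nullary using (¬_; does)
open import Data.Bool using (if_then_else_)

IsPrimePower : ℕ → Set
IsPrimePower q = Σ ℕ λ p → Σ ℕ λ k → Prime p × 1 ≤ k × q ≡ p ℕ.^ k

-- q is a primitive root modulo the prime m (m ≥ 2):
-- m ∤ q and the multiplicative order of q mod m is not smaller than m - 1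
-- (by Fermat it then equals m - 1 = φ(m)).
IsPrimitiveRootMod : ℕ → (m : ℕ) → .{{ℕ.NonZero m}} → Set
IsPrimitiveRootMod q m = ¬ (m ∣ q) × (∀ k → 1 ≤ k → k < m ∸ 1 → (q ℕ.^ k) % m ≢ 1)

sumℕ : ∀ {n} → (Fin n → ℕ) → ℕ
sumℕ {zero} f = 0
sumℕ {suc n} f = f Fin.zero ℕ.+ sumℕ (λ i → f (Fin.suc i))

module FieldDefs {c ℓ : Level} (R : CommutativeRing c ℓ) where
  open CommutativeRing R
  open import Algebra.Definitions.RawSemiring (Semiring.rawSemiring semiring) using (sum) renaming (_^_ to _^#_) public

  IsField : Set (c ⊔ ℓ)
  IsField = (0# ≉ 1#) × (∀ x → x ≉ 0# → Σ Carrier λ y → x * y ≈ 1#)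

  HasCardinality : ℕ → Set (c ⊔ ℓ)
  HasCardinality N = Σ (Fin N → Carrier) λ e →
    (∀ i j → e i ≈ e j → i ≡ j) × (∀ x → Σ (Fin N) λ i → e i ≈ x)

  -- For a field L with q^n elements, F_q ⊆ L is { x | x^q = x }.
  InBaseField : ℕ → Carrier → Set ℓ
  InBaseField q x = x ^# q ≈ x

  conj : ℕ → Carrier → ℕ → Carrier
  conj q x i = x ^# (q ℕ.^ i)

  Tr : ℕ → (n : ℕ) → Carrier → Carrier
  Tr q n x = sum {n} (λ i → conj q x (toℕ i))

  IsDualNormalGenerator : ℕ → (n : ℕ) → Carrier → Carrier → Set ℓ
  IsDualNormalGenerator q n α β = ∀ (i j : Fin n) →
    (i ≡ j → Tr q n (conj q α (toℕ i) * conj q β (toℕ j)) ≈ 1#) ×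
    (i ≢ j → Tr q n (conj q α (toℕ i) * conj q β (toℕ j)) ≈ 0#)

  module WithDecEq (_≟_ : Decidable _≈_) where
    nonzeroCount : ∀ {n} → (Fin n → Fin n → Carrier) → ℕ
    nonzeroCount t = sumℕ λ i → sumℕ λ j → if does (t i j ≟ 0#) then 0 else 1

    NormalBasisComplexity : ℕ → (n : ℕ) → Carrier → ℕ → Set (c ⊔ ℓ)
    NormalBasisComplexity q n β k = Σ (Fin n → Fin n → Carrier) λ t →
      (∀ i j → InBaseField q (t i j)) ×
      (∀ i → β * conj q β (toℕ i) ≈ sum (λ j → t i j * conj q β (toℕ j))) ×
      nonzeroCount t ≡ k

module Submission where

-- With M = n + 1 and ᾱⱼ = α ^ (-qʲ), the dual generator satisfies M βⱼ = ᾱⱼ - 1: pairing the vector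
-- (ᾱᵢ - 1)ᵢ with the trace matrix Tr(αᵢ βⱼ) = δᵢⱼ, each column k contributes Σᵢ (ᾱᵢ - 1) αᵢ^(qᵏ), a
-- difference of two sums over all nontrivial (n+1)-th roots of unity (q being primitive), which is
-- 0 for k ≠ 0 and M for k = 0.
-- Consequently M² β βᵢ = (ᾱ₀ ᾱᵢ - 1) - M β - M βᵢ, and ᾱ₀ ᾱᵢ = α ^ (-(1 + qⁱ)) is ᾱₖ for the Zech
-- logarithm k of i (qᵏ ≡ 1 + qⁱ), or 1 for the single i with qⁱ ≡ -1. So β βᵢ = (βₖ - β - βᵢ) / M:
-- three nonzero coefficients per row, except that row 0 merges two of them into -2 / M, which
-- vanishes exactly in characteristic 2, and the row with qⁱ ≡ -1 has no βₖ.

open import Level using (Level)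
open import Algebra.Bundles using (CommutativeRing)
open import Data.Nat as ℕ using (ℕ; zero; suc)
open import Data.Nat.Divisibility using (_∣_; divides; ∣-trans; m∣m*n; m%n≡0⇒n∣m)
import Data.Nat.Properties as ℕ
open import Data.Nat.Primality using (Prime; prime⇒nonZero; prime⇒irreducible; prime[2])
open import Data.Nat.DivMod using (_/_; _%_; m≡m%n+[m/n]*n; m%n<n)
open import Data.Nat.Combinatorics using (_C_; nCn≡1)
open import Data.Fin as Fin using (Fin; toℕ)
import Data.Fin.Properties as Fin
open import Data.Fin.Permutation using (permutation)
open import Data.Bool using (Bool; true; false; if_then_else_)
open import Data.Product using (Σ; _,_; proj₁; proj₂)
open import Data.Sum using (_⊎_; inj₁; inj₂)
open import Function.Base using (_∘_)
open import Relation.Nullary using (¬_; yes; no; does; contradiction)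
open import Relation.Binary.Definitions using (Decidable)
open import Relation.Binary.PropositionalEquality as ≡ using (_≡_; _≢_)
open import Defs

module Arithmetic where
  open import Data.Nat
  open import Data.Nat.Properties
  open import Data.Nat.DivMod
  open import Data.Nat.Divisibility
  open import Data.Nat.Primality
  open import Data.Nat.Combinatorics using (_C_; nCk≡n!/k![n-k]!; k![n∸k]!∣n!)
  open import Data.Fin.Permutation using (Permutation′; _⟨$⟩ʳ_)
  open import Data.Product using (∃)
  open import Function.Definitions using (Injective)
  open import Relation.Binary.PropositionalEquality

  injective⇒surjective : ∀ {k} {f : Fin k → Fin k} → Injective _≡_ _≡_ f → ∀ y → ∃ λ i → f i ≡ y
  injective⇒surjective {suc k} {f} f-inj y with Fin.any? (λ i → f i Fin.≟ y)
  ... | yes hit = hit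
  ... | no miss = contradiction (Fin.injective⇒≤ punchOut-inj) (<-irrefl refl)
    where
    f≢y : ∀ i → y ≢ f i
    f≢y i y≡fi = miss (i , sym y≡fi)
    punchOut-inj : Injective _≡_ _≡_ (λ i → Fin.punchOut (f≢y i))
    punchOut-inj eq = f-inj (Fin.punchOut-injective (f≢y _) (f≢y _) eq)

  injective⇒permutation : ∀ {k} {f : Fin k → Fin k} → Injective _≡_ _≡_ f →
                          Σ (Permutation′ k) λ π → ∀ i → π ⟨$⟩ʳ i ≡ f i
  injective⇒permutation {f = f} f-inj =
    permutation f f⁻¹ (λ y → proj₂ (onto y)) (λ i → f-inj (proj₂ (onto (f i)))) , λ _ → refl
    where
    onto = injective⇒surjective f-inj
    f⁻¹ = λ y → proj₁ (onto y)

  prime∣^⇒∣ : ∀ {p} a j → Prime p → p ∣ a ^ j → p ∣ a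
  prime∣^⇒∣ a zero    pr p∣1 = contradiction (subst Prime (∣1⇒≡1 p∣1) pr) ¬prime[1]
  prime∣^⇒∣ a (suc j) pr p∣a*aʲ with euclidsLemma a (a ^ j) pr p∣a*aʲ
  ... | inj₁ p∣a  = p∣a
  ... | inj₂ p∣aʲ = prime∣^⇒∣ a j pr p∣aʲ

  prime∤! : ∀ {p} → Prime p → ∀ j → j < p → ¬ p ∣ j !
  prime∤! pr zero    _   p∣1 = ¬prime[1] (subst Prime (∣1⇒≡1 p∣1) pr)
  prime∤! pr (suc j) j<p p∣j! with euclidsLemma (suc j) (j !) pr p∣j!
  ... | inj₁ p∣1+j = <⇒≱ j<p (∣⇒≤ p∣1+j)
  ... | inj₂ p∣j!  = prime∤! pr j (<-trans (n<1+n j) j<p) p∣j!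

  n∣n! : ∀ n .{{_ : NonZero n}} → n ∣ n !
  n∣n! (suc n) = m∣m*n (n !)

  prime∣C : ∀ {p} → Prime p → ∀ k → 0 < k → k < p → p ∣ p C k
  prime∣C {p} pr k 0<k k<p with euclidsLemma (p C k) (k ! * (p ∸ k) !) pr p∣C*k!*[p-k]!
    where
    instance _ = k !* (p ∸ k) !≢0
    C*k!*[p-k]!≡p! : (p C k) * (k ! * (p ∸ k) !) ≡ p !
    C*k!*[p-k]!≡p! = trans (cong (_* (k ! * (p ∸ k) !)) (nCk≡n!/k![n-k]! (<⇒≤ k<p))) (m/n*n≡m (k![n∸k]!∣n! (<⇒≤ k<p)))
    p∣C*k!*[p-k]! = subst (p ∣_) (sym C*k!*[p-k]!≡p!) (n∣n! p {{prime⇒nonZero pr}})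
  ... | inj₁ p∣C = p∣C
  ... | inj₂ p∣k!*[p-k]! with euclidsLemma (k !) ((p ∸ k) !) pr p∣k!*[p-k]!
  ... | inj₁ p∣k!     = contradiction p∣k! (prime∤! pr k k<p)
  ... | inj₂ p∣[p-k]! = contradiction p∣[p-k]! (prime∤! pr (p ∸ k) (∸-monoʳ-< 0<k (<⇒≤ k<p)))

  module _ {m : ℕ} .{{_ : NonZero m}} where

    %-≡⇒∣∸ : ∀ {x y} → x ≤ y → x % m ≡ y % m → m ∣ y ∸ x
    %-≡⇒∣∸ {x} {y} x≤y x≡y = divides (y / m ∸ x / m) (begin
        y ∸ x                                      ≡⟨ cong₂ _∸_ (m≡m%n+[m/n]*n y m) (m≡m%n+[m/n]*n x m) ⟩
        (y % m + y / m * m) ∸ (x % m + x / m * m)  ≡⟨ cong (λ r → (y % m + _) ∸ (r + _)) x≡y ⟩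
        (y % m + y / m * m) ∸ (y % m + x / m * m)  ≡⟨ [m+n]∸[m+o]≡n∸o (y % m) _ _ ⟩
        y / m * m ∸ x / m * m                      ≡⟨ *-distribʳ-∸ m (y / m) (x / m) ⟨
        (y / m ∸ x / m) * m                        ∎)
      where open ≡-Reasoning

    ∣∸⇒%-≡ : ∀ {x y} → x ≤ y → m ∣ y ∸ x → x % m ≡ y % m
    ∣∸⇒%-≡ {x} {y} x≤y (divides k y∸x≡km) = begin
        x % m                ≡⟨ [m+kn]%n≡m%n x k m ⟨
        (x + k * m) % m      ≡⟨ cong (λ z → (x + z) % m) y∸x≡km ⟨
        (x + (y ∸ x)) % m    ≡⟨ cong (_% m) (m+[n∸m]≡n x≤y) ⟩
        y % m                ∎
      where open ≡-Reasoning

    %-≡-*ˡ : ∀ c {x y} → x % m ≡ y % m → (c * x) % m ≡ (c * y) % m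
    %-≡-*ˡ c {x} {y} x≡y = trans (%-distribˡ-* c x m)
      (trans (cong (λ z → ((c % m) * z) % m) x≡y) (sym (%-distribˡ-* c y m)))

  module PowersOfPrimitiveRoot (n q : ℕ) (prime : Prime (suc n)) (q-primitive : IsPrimitiveRootMod q (suc n)) where

    1≤n : 1 ≤ n
    1≤n = s≤s⁻¹ (nonTrivial⇒n>1 (suc n) {{prime⇒nonTrivial prime}})

    instance
      q-nonZero : NonZero q
      q-nonZero = ≢-nonZero λ q≡0 → proj₁ q-primitive (subst (suc n ∣_) (sym q≡0) (suc n ∣0))

    ∤q^ : ∀ i → ¬ suc n ∣ q ^ i
    ∤q^ zero    ∣1   = <-irrefl (sym (∣1⇒≡1 ∣1)) (s≤s 1≤n)
    ∤q^ (suc i) ∣q*qⁱ with euclidsLemma q (q ^ i) prime ∣q*qⁱ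
    ... | inj₁ ∣q  = proj₁ q-primitive ∣q
    ... | inj₂ ∣qⁱ = ∤q^ i ∣qⁱ

    ∤*q^ : ∀ {e} → ¬ suc n ∣ e → ∀ i → ¬ suc n ∣ e * q ^ i
    ∤*q^ {e} ∤e i ∣e*qⁱ with euclidsLemma e (q ^ i) prime ∣e*qⁱ
    ... | inj₁ ∣e  = ∤e ∣e
    ... | inj₂ ∣qⁱ = ∤q^ i ∣qⁱ

    ∤q^∸1 : ∀ d → 1 ≤ d → d < n → ¬ suc n ∣ q ^ d ∸ 1
    ∤q^∸1 d 1≤d d<n ∣qᵈ∸1 = proj₂ q-primitive d 1≤d d<n
      (trans (sym (∣∸⇒%-≡ (m^n>0 q d) ∣qᵈ∸1)) (m<n⇒m%n≡m (s≤s 1≤n)))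

    private
      *q^-%-injective-≤ : ∀ {e} → ¬ suc n ∣ e → ∀ {a b} → a ≤ b → b < n →
                          (e * q ^ a) % suc n ≡ (e * q ^ b) % suc n → a ≡ b
      *q^-%-injective-≤ {e} ∤e {a} {b} a≤b b<n eq with b ∸ a in b∸a≡d
      ... | zero  = ≤-antisym a≤b (m∸n≡0⇒m≤n b∸a≡d)
      ... | suc d = contradiction ∣qᵈ∸1 (∤q^∸1 (suc d) (s≤s z≤n) (≤-<-trans (subst (_≤ b) b∸a≡d (m∸n≤m b a)) b<n))
        where
        x = e * q ^ a
        b≡a+d : b ≡ a + suc d
        b≡a+d = trans (sym (m+[n∸m]≡n a≤b)) (cong (a +_) b∸a≡d)
        y≡x*qᵈ : e * q ^ b ≡ x * q ^ suc d
        y≡x*qᵈ = trans (cong (λ z → e * q ^ z) b≡a+d) (trans (cong (e *_) (^-distribˡ-+-* q a (suc d))) (sym (*-assoc e (q ^ a) _)))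
        ∣x*[qᵈ∸1] : suc n ∣ x * (q ^ suc d ∸ 1)
        ∣x*[qᵈ∸1] = subst (suc n ∣_) (trans (cong (_∸ x) y≡x*qᵈ) (sym (trans (*-distribˡ-∸ x _ 1) (cong (x * q ^ suc d ∸_) (*-identityʳ x)))))
          (%-≡⇒∣∸ (subst (x ≤_) (sym y≡x*qᵈ) (m≤m*n x (q ^ suc d) {{m^n≢0 q (suc d)}})) eq)
        ∣qᵈ∸1 : suc n ∣ q ^ suc d ∸ 1
        ∣qᵈ∸1 with euclidsLemma x _ prime ∣x*[qᵈ∸1]
        ... | inj₁ ∣x     = contradiction ∣x (∤*q^ ∤e a)
        ... | inj₂ ∣qᵈ∸1′ = ∣qᵈ∸1′

    *q^-%-injective : ∀ {e} → ¬ suc n ∣ e → ∀ {a b} → a < n → b < n →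
                      (e * q ^ a) % suc n ≡ (e * q ^ b) % suc n → a ≡ b
    *q^-%-injective ∤e {a} {b} a<n b<n eq with ≤-total a b
    ... | inj₁ a≤b = *q^-%-injective-≤ ∤e a≤b b<n eq
    ... | inj₂ b≤a = sym (*q^-%-injective-≤ ∤e b≤a a<n (sym eq))

    q^-%-injective : ∀ {a b} → a < n → b < n → q ^ a % suc n ≡ q ^ b % suc n → a ≡ b
    q^-%-injective {a} {b} a<n b<n eq = *q^-%-injective (∤q^ 0) a<n b<n
      (trans (cong (_% suc n) (*-identityˡ (q ^ a))) (trans eq (cong (_% suc n) (sym (*-identityˡ (q ^ b))))))

    residue : ∀ x → ¬ suc n ∣ x → Σ (Fin n) λ r → suc (toℕ r) ≡ x % suc n
    residue x ∤x with x % suc n | m%n<n x (suc n) | m%n≡0⇒n∣m x (suc n)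
    ... | zero  | _           | ∣x = contradiction (∣x refl) ∤x
    ... | suc r | s≤s r<n     | _  = Fin.fromℕ< r<n , cong suc (Fin.toℕ-fromℕ< r<n)

    orbit : ∀ {e} → ¬ suc n ∣ e → Fin n → Fin n
    orbit {e} ∤e i = proj₁ (residue (e * q ^ toℕ i) (∤*q^ ∤e (toℕ i)))

    orbit-spec : ∀ {e} (∤e : ¬ suc n ∣ e) i → suc (toℕ (orbit ∤e i)) ≡ (e * q ^ toℕ i) % suc n
    orbit-spec {e} ∤e i = proj₂ (residue (e * q ^ toℕ i) (∤*q^ ∤e (toℕ i)))

    orbit-injective : ∀ {e} (∤e : ¬ suc n ∣ e) → Injective _≡_ _≡_ (orbit ∤e)
    orbit-injective ∤e {i} {j} eq = Fin.toℕ-injective (*q^-%-injective ∤e (Fin.toℕ<n i) (Fin.toℕ<n j)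
      (trans (sym (orbit-spec ∤e i)) (trans (cong (suc ∘ toℕ) eq) (orbit-spec ∤e j))))

    log : ∀ x → ¬ suc n ∣ x → Σ (Fin n) λ k → q ^ toℕ k % suc n ≡ x % suc n
    log x ∤x = k , (begin
        q ^ toℕ k % suc n              ≡⟨ cong (_% suc n) (*-identityˡ (q ^ toℕ k)) ⟨
        (1 * q ^ toℕ k) % suc n        ≡⟨ orbit-spec (∤q^ 0) k ⟨
        suc (toℕ (orbit (∤q^ 0) k))    ≡⟨ cong (suc ∘ toℕ) orbit-k≡r ⟩
        suc (toℕ r)                    ≡⟨ proj₂ (residue x ∤x) ⟩
        x % suc n                      ∎)
      where
      open ≡-Reasoning
      r = proj₁ (residue x ∤x)
      k = proj₁ (injective⇒surjective (orbit-injective (∤q^ 0)) r)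
      orbit-k≡r = proj₂ (injective⇒surjective (orbit-injective (∤q^ 0)) r)

    ∤n+q^ : ∀ k → 1 ≤ k → k < n → ¬ suc n ∣ n + q ^ k
    ∤n+q^ k 1≤k k<n ∣n+qᵏ = ∤q^∸1 k 1≤k k<n (∣m+n∣m⇒∣n (subst (suc n ∣_) n+qᵏ≡suc[n]+[qᵏ∸1] ∣n+qᵏ) ∣-refl)
      where
      n+qᵏ≡suc[n]+[qᵏ∸1] : n + q ^ k ≡ suc n + (q ^ k ∸ 1)
      n+qᵏ≡suc[n]+[qᵏ∸1] = trans (cong (n +_) (sym (m+[n∸m]≡n (m^n>0 q k)))) (+-suc n _)

    -- k is Zech's logarithm of i: q ^ k ≡ 1 + q ^ i. It is undefined when 1 + q ^ i ≡ 0.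
    IsZechLog : Fin n → Fin n → Set
    IsZechLog i k = q ^ toℕ k % suc n ≡ (1 + q ^ toℕ i) % suc n

    data ZechView (i : Fin n) : Set where
      zech      : (k : Fin n) → IsZechLog i k → ZechView i
      undefined : (1 + q ^ toℕ i) % suc n ≡ 0 → ZechView i

    zechView : ∀ i → ZechView i
    zechView i with (1 + q ^ toℕ i) % suc n ≟ 0
    ... | yes ≡0 = undefined ≡0
    ... | no  ≢0 = let (k , eq) = log (1 + q ^ toℕ i) (≢0 ∘ n∣m⇒m%n≡0 _ (suc n)) in zech k eq

    zech≢0 : ∀ {i k} → IsZechLog i k → toℕ k ≢ 0
    zech≢0 {i} eq k≡0 = ∤q^ (toℕ i) (%-≡⇒∣∸ (s≤s z≤n) (trans (cong (λ z → q ^ z % suc n) (sym k≡0)) eq))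

    zech≢self : ∀ {i k} → IsZechLog i k → k ≢ i
    zech≢self {i} eq refl = ∤q^ 0 (subst (suc n ∣_) (m+n∸n≡m 1 (q ^ toℕ i)) (%-≡⇒∣∸ (n≤1+n _) eq))

    antipode : Fin n
    antipode = proj₁ (log n λ ∣n → <-irrefl refl (∣⇒≤ {{>-nonZero 1≤n}} ∣n))

    antipode-spec : q ^ toℕ antipode % suc n ≡ n
    antipode-spec = trans (proj₂ (log n _)) (m<n⇒m%n≡m (n<1+n n))

    undefined⇒≡antipode : ∀ {i} → (1 + q ^ toℕ i) % suc n ≡ 0 → i ≡ antipode
    undefined⇒≡antipode {i} eq = Fin.toℕ-injective
      (q^-%-injective (Fin.toℕ<n i) (Fin.toℕ<n antipode) (trans (%-pred-≡0 eq) (sym antipode-spec)))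

    antipode-undefined : (1 + q ^ toℕ antipode) % suc n ≡ 0
    antipode-undefined = begin
      (1 + q ^ toℕ antipode) % suc n                  ≡⟨ %-distribˡ-+ 1 (q ^ toℕ antipode) (suc n) ⟩
      (1 % suc n + q ^ toℕ antipode % suc n) % suc n  ≡⟨ cong₂ (λ a b → (a + b) % suc n) (m<n⇒m%n≡m (s≤s 1≤n)) antipode-spec ⟩
      suc n % suc n                                   ≡⟨ n%n≡0 (suc n) ⟩
      0                                               ∎
      where open ≡-Reasoning

    zech⇒≢antipode : ∀ {i k} → IsZechLog i k → i ≢ antipode
    zech⇒≢antipode {k = k} eq refl = ∤q^ (toℕ k) (m%n≡0⇒n∣m _ (suc n) (trans eq antipode-undefined))

open Arithmetic

module Counting where
  open import Data.Nat
  open import Data.Nat.Properties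
  open import Algebra.Properties.CommutativeSemigroup +-commutativeSemigroup using (interchange)
  open import Relation.Binary.PropositionalEquality

  bit : Bool → ℕ
  bit true  = 1
  bit false = 0

  δ : ∀ {n} → Fin n → Fin n → Bool
  δ a j = does (a Fin.≟ j)

  sumℕ-cong : ∀ {k} {f g : Fin k → ℕ} → (∀ j → f j ≡ g j) → sumℕ f ≡ sumℕ g
  sumℕ-cong {zero}  f≡g = refl
  sumℕ-cong {suc k} f≡g = cong₂ _+_ (f≡g Fin.zero) (sumℕ-cong (f≡g ∘ Fin.suc))

  sumℕ-+ : ∀ {k} (f g : Fin k → ℕ) → sumℕ (λ j → f j + g j) ≡ sumℕ f + sumℕ g
  sumℕ-+ {zero}  f g = refl
  sumℕ-+ {suc k} f g = trans (cong (f Fin.zero + g Fin.zero +_) (sumℕ-+ (f ∘ Fin.suc) (g ∘ Fin.suc)))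
                             (interchange (f Fin.zero) (g Fin.zero) _ _)

  sumℕ-*ʳ : ∀ {k} (f : Fin k → ℕ) c → sumℕ (λ j → f j * c) ≡ sumℕ f * c
  sumℕ-*ʳ {zero}  f c = refl
  sumℕ-*ʳ {suc k} f c = trans (cong (f Fin.zero * c +_) (sumℕ-*ʳ (f ∘ Fin.suc) c)) (sym (*-distribʳ-+ c (f Fin.zero) _))

  sumℕ-const : ∀ k c → sumℕ {k} (λ _ → c) ≡ k * c
  sumℕ-const zero    c = refl
  sumℕ-const (suc k) c = cong (c +_) (sumℕ-const k c)

  sumℕ-δ : ∀ {k} (a : Fin k) → sumℕ (λ j → bit (δ a j)) ≡ 1
  sumℕ-δ {suc k} Fin.zero    = cong suc (trans (sumℕ-const k 0) (*-zeroʳ k))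
  sumℕ-δ {suc k} (Fin.suc a) = sumℕ-δ a

  -- tally w x y z is 1 if 𝟙 x - 𝟙 y - 𝟙 z ≠ 0 and 0 otherwise, in a ring where 1 + 1 ≠ 0 exactly when w ≡ 1.
  tally : ℕ → Bool → Bool → Bool → ℕ
  tally w false false false = 0
  tally w true  false false = 1
  tally w false true  false = 1
  tally w false false true  = 1
  tally w true  true  false = 0
  tally w true  false true  = 0
  tally w false true  true  = w
  tally w true  true  true  = 1

  module _ {k : ℕ} (w : ℕ) where

    sumℕ-tally-distinct : ∀ {a b c : Fin k} → a ≢ b → a ≢ c → b ≢ c →
                          sumℕ (λ j → tally w (δ a j) (δ b j) (δ c j)) ≡ 3
    sumℕ-tally-distinct {a} {b} {c} a≢b a≢c b≢c = begin
      sumℕ (λ j → tally w (δ a j) (δ b j) (δ c j))              ≡⟨ sumℕ-cong pointwise ⟩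
      sumℕ (λ j → bit (δ a j) + bit (δ b j) + bit (δ c j))      ≡⟨ trans (sumℕ-+ (λ j → bit (δ a j) + bit (δ b j)) (bit ∘ δ c))
                                                                     (cong (_+ sumℕ (bit ∘ δ c)) (sumℕ-+ (bit ∘ δ a) (bit ∘ δ b))) ⟩
      sumℕ (λ j → bit (δ a j)) + sumℕ (λ j → bit (δ b j)) + sumℕ (λ j → bit (δ c j))
                                                                ≡⟨ cong₂ _+_ (cong₂ _+_ (sumℕ-δ a) (sumℕ-δ b)) (sumℕ-δ c) ⟩
      3                                                         ∎
      where
      open ≡-Reasoning
      pointwise : ∀ j → tally w (δ a j) (δ b j) (δ c j) ≡ bit (δ a j) + bit (δ b j) + bit (δ c j)
      pointwise j with a Fin.≟ j | b Fin.≟ j | c Fin.≟ j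
      ... | yes refl | yes b≡j | _        = contradiction (sym b≡j) a≢b
      ... | yes refl | no _    | yes c≡j  = contradiction (sym c≡j) a≢c
      ... | no _     | yes refl | yes c≡j = contradiction (sym c≡j) b≢c
      ... | yes _    | no _    | no _     = refl
      ... | no _     | yes _   | no _     = refl
      ... | no _     | no _    | yes _    = refl
      ... | no _     | no _    | no _     = refl

    sumℕ-tally-double : ∀ {a b : Fin k} → a ≢ b → sumℕ (λ j → tally w (δ a j) (δ b j) (δ b j)) ≡ 1 + w
    sumℕ-tally-double {a} {b} a≢b = begin
      sumℕ (λ j → tally w (δ a j) (δ b j) (δ b j))     ≡⟨ sumℕ-cong pointwise ⟩
      sumℕ (λ j → bit (δ a j) + bit (δ b j) * w)       ≡⟨ sumℕ-+ (bit ∘ δ a) (λ j → bit (δ b j) * w) ⟩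
      sumℕ (λ j → bit (δ a j)) + sumℕ (λ j → bit (δ b j) * w)
        ≡⟨ cong₂ _+_ (sumℕ-δ a) (trans (sumℕ-*ʳ (bit ∘ δ b) w) (cong (_* w) (sumℕ-δ b))) ⟩
      1 + 1 * w                                        ≡⟨ cong (1 +_) (*-identityˡ w) ⟩
      1 + w                                            ∎
      where
      open ≡-Reasoning
      pointwise : ∀ j → tally w (δ a j) (δ b j) (δ b j) ≡ bit (δ a j) + bit (δ b j) * w
      pointwise j with a Fin.≟ j | b Fin.≟ j
      ... | yes refl | yes b≡j = contradiction (sym b≡j) a≢b
      ... | yes _    | no _    = refl
      ... | no _     | yes _   = sym (+-identityʳ w)
      ... | no _     | no _    = refl

    sumℕ-tally-pair : ∀ {b c : Fin k} → b ≢ c → sumℕ (λ j → tally w false (δ b j) (δ c j)) ≡ 2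
    sumℕ-tally-pair {b} {c} b≢c = trans (sumℕ-cong pointwise) (trans (sumℕ-+ (bit ∘ δ b) (bit ∘ δ c)) (cong₂ _+_ (sumℕ-δ b) (sumℕ-δ c)))
      where
      pointwise : ∀ j → tally w false (δ b j) (δ c j) ≡ bit (δ b j) + bit (δ c j)
      pointwise j with b Fin.≟ j | c Fin.≟ j
      ... | yes refl | yes c≡j = contradiction (sym c≡j) b≢c
      ... | yes _    | no _    = refl
      ... | no _     | yes _   = refl
      ... | no _     | no _    = refl

    sumℕ-tally-single : ∀ (b : Fin k) → sumℕ (λ j → tally w false (δ b j) (δ b j)) ≡ w
    sumℕ-tally-single b = trans (sumℕ-cong pointwise) (trans (sumℕ-*ʳ (bit ∘ δ b) w) (trans (cong (_* w) (sumℕ-δ b)) (*-identityˡ w)))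
      where
      pointwise : ∀ j → tally w false (δ b j) (δ b j) ≡ bit (δ b j) * w
      pointwise j with b Fin.≟ j
      ... | yes _ = sym (+-identityʳ w)
      ... | no _  = refl

  sumℕ-rows : ∀ {k} (R : Fin k → ℕ) (a b : Fin k) (w : ℕ) →
              (∀ i → R i + bit (δ a i) + bit (δ b i) * 2 ≡ 3 + bit (δ b i) * w) →
              sumℕ R ≡ 3 * k + w ∸ 3
  sumℕ-rows {k} R a b w rows = begin
    sumℕ R               ≡⟨ m+n∸n≡m (sumℕ R) 3 ⟨
    sumℕ R + 3 ∸ 3       ≡⟨ cong (_∸ 3) total ⟩
    k * 3 + w ∸ 3        ≡⟨ cong (λ z → z + w ∸ 3) (*-comm k 3) ⟩
    3 * k + w ∸ 3        ∎
    where
    open ≡-Reasoning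
    total : sumℕ R + 3 ≡ k * 3 + w
    total = begin
      sumℕ R + 3                                                           ≡⟨ +-assoc (sumℕ R) 1 2 ⟨
      sumℕ R + 1 + 2                                                       ≡⟨ cong₂ (λ x y → sumℕ R + x + y) (sumℕ-δ a) (cong (_* 2) (sumℕ-δ b)) ⟨
      sumℕ R + sumℕ (bit ∘ δ a) + sumℕ (bit ∘ δ b) * 2                     ≡⟨ cong (_ +_) (sumℕ-*ʳ (bit ∘ δ b) 2) ⟨
      sumℕ R + sumℕ (bit ∘ δ a) + sumℕ (λ i → bit (δ b i) * 2)             ≡⟨ cong (_+ _) (sumℕ-+ R (bit ∘ δ a)) ⟨
      sumℕ (λ i → R i + bit (δ a i)) + sumℕ (λ i → bit (δ b i) * 2)        ≡⟨ sumℕ-+ (λ i → R i + bit (δ a i)) (λ i → bit (δ b i) * 2) ⟨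
      sumℕ (λ i → R i + bit (δ a i) + bit (δ b i) * 2)                     ≡⟨ sumℕ-cong rows ⟩
      sumℕ (λ i → 3 + bit (δ b i) * w)                                     ≡⟨ sumℕ-+ (λ _ → 3) (λ i → bit (δ b i) * w) ⟩
      sumℕ {k} (λ _ → 3) + sumℕ (λ i → bit (δ b i) * w)
        ≡⟨ cong₂ _+_ (sumℕ-const k 3) (trans (sumℕ-*ʳ (bit ∘ δ b) w) (cong (_* w) (sumℕ-δ b))) ⟩
      k * 3 + 1 * w                                                        ≡⟨ cong (k * 3 +_) (*-identityˡ w) ⟩
      k * 3 + w                                                            ∎

open Counting

-- Ring normalisation needs integer coefficients, i.e. the canonical map ℤ → R as a ring morphism.
module RingSolver {c ℓ : Level} (R : CommutativeRing c ℓ) where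
  open import Data.Integer as ℤ using (ℤ; +_; -[1+_])
  import Data.Integer.Properties as ℤP
  open import Data.Sign as Sign using (Sign)
  open import Data.Maybe using (Maybe; just; nothing)
  open CommutativeRing R
  open import Algebra.Properties.Ring ring using (-‿distribˡ-*; -‿distribʳ-*)
  open import Algebra.Properties.Group +-group using (ε⁻¹≈ε; ⁻¹-involutive; ⁻¹-anti-homo-∙)
  open import Algebra.Properties.AbelianGroup +-abelianGroup using (⁻¹-∙-comm)
  open import Algebra.Properties.Semiring.Mult.TCOptimised semiring using (_×_; ×-homo-+; ×1-homo-*; 1+×)
  open import Algebra.Solver.Ring.AlmostCommutativeRing using (fromCommutativeRing; _-Raw-AlmostCommutative⟶_)
  open import Relation.Binary.Reasoning.Setoid setoid

  private
    -- With the optimised _×_, fromℤ (+ 1) is literally 1#, so constants in goals match the solver's output.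
    fromℤ : ℤ → Carrier
    fromℤ (+ n) = n × 1#
    fromℤ -[1+ n ] = - (suc n × 1#)

    signed : Sign → Carrier → Carrier
    signed Sign.+ x = x
    signed Sign.- x = - x

    signed-cong : ∀ s {x y} → x ≈ y → signed s x ≈ signed s y
    signed-cong Sign.+ x≈y = x≈y
    signed-cong Sign.- x≈y = -‿cong x≈y

    signed-* : ∀ s t x y → signed (s Sign.* t) (x * y) ≈ signed s x * signed t y
    signed-* Sign.+ Sign.+ x y = refl
    signed-* Sign.+ Sign.- x y = -‿distribʳ-* x y
    signed-* Sign.- Sign.+ x y = -‿distribˡ-* x y
    signed-* Sign.- Sign.- x y = begin
      x * y         ≈⟨ ⁻¹-involutive (x * y) ⟨
      - - (x * y)   ≈⟨ -‿cong (-‿distribˡ-* x y) ⟩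
      - (- x * y)   ≈⟨ -‿distribʳ-* (- x) y ⟩
      - x * - y     ∎

    fromℤ-◃ : ∀ s n → fromℤ (s ℤ.◃ n) ≈ signed s (n × 1#)
    fromℤ-◃ Sign.+   zero    = refl
    fromℤ-◃ Sign.-   zero    = sym ε⁻¹≈ε
    fromℤ-◃ Sign.+   (suc n) = refl
    fromℤ-◃ Sign.-   (suc n) = refl

    fromℤ-signAbs : ∀ i → fromℤ i ≈ signed (ℤ.sign i) (ℤ.∣ i ∣ × 1#)
    fromℤ-signAbs (+ n)    = refl
    fromℤ-signAbs -[1+ n ] = refl

    fromℤ-⊖ : ∀ m n → fromℤ (m ℤ.⊖ n) ≈ m × 1# - n × 1#
    fromℤ-⊖ m       zero    = sym (trans (+-congˡ ε⁻¹≈ε) (+-identityʳ _))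
    fromℤ-⊖ zero    (suc n) = sym (+-identityˡ _)
    fromℤ-⊖ (suc m) (suc n) = begin
      fromℤ (suc m ℤ.⊖ suc n)        ≡⟨ ≡.cong fromℤ (ℤP.[1+m]⊖[1+n]≡m⊖n m n) ⟩
      fromℤ (m ℤ.⊖ n)                ≈⟨ fromℤ-⊖ m n ⟩
      x - y                          ≈⟨ +-identityˡ (x - y) ⟨
      0# + (x - y)                   ≈⟨ +-congʳ (-‿inverseʳ 1#) ⟨
      (1# - 1#) + (x - y)            ≈⟨ +-assoc 1# (- 1#) (x - y) ⟩
      1# + (- 1# + (x - y))          ≈⟨ +-congˡ (+-comm (- 1#) (x - y)) ⟩
      1# + ((x - y) - 1#)            ≈⟨ +-congˡ (+-assoc x (- y) (- 1#)) ⟩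
      1# + (x + (- y - 1#))          ≈⟨ +-assoc 1# x (- y - 1#) ⟨
      (1# + x) + (- y - 1#)          ≈⟨ +-congˡ (⁻¹-anti-homo-∙ 1# y) ⟨
      (1# + x) - (1# + y)            ≈⟨ +-cong (1+× m 1#) (-‿cong (1+× n 1#)) ⟨
      suc m × 1# - suc n × 1#        ∎
      where x = m × 1#; y = n × 1#

    fromℤ-+ : ∀ i j → fromℤ (i ℤ.+ j) ≈ fromℤ i + fromℤ j
    fromℤ-+ (+ m)    (+ n)    = ×-homo-+ 1# m n
    fromℤ-+ (+ m)    -[1+ n ] = fromℤ-⊖ m (suc n)
    fromℤ-+ -[1+ m ] (+ n)    = trans (fromℤ-⊖ n (suc m)) (+-comm _ _)
    fromℤ-+ -[1+ m ] -[1+ n ] = begin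
      - (suc (suc (m ℕ.+ n)) × 1#)     ≡⟨ ≡.cong (λ k → - (k × 1#)) (≡.sym (ℕP.+-suc (suc m) n)) ⟩
      - ((suc m ℕ.+ suc n) × 1#)       ≈⟨ -‿cong (×-homo-+ 1# (suc m) (suc n)) ⟩
      - (suc m × 1# + suc n × 1#)      ≈⟨ ⁻¹-∙-comm _ _ ⟨
      - (suc m × 1#) + - (suc n × 1#)  ∎
      where import Data.Nat.Properties as ℕP

    fromℤ-* : ∀ i j → fromℤ (i ℤ.* j) ≈ fromℤ i * fromℤ j
    fromℤ-* i j = begin
      fromℤ (i ℤ.* j)                          ≈⟨ fromℤ-◃ s (ℤ.∣ i ∣ ℕ.* ℤ.∣ j ∣) ⟩
      signed s ((ℤ.∣ i ∣ ℕ.* ℤ.∣ j ∣) × 1#)   ≈⟨ signed-cong s (×1-homo-* ℤ.∣ i ∣ ℤ.∣ j ∣) ⟩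
      signed s ((ℤ.∣ i ∣ × 1#) * (ℤ.∣ j ∣ × 1#)) ≈⟨ signed-* (ℤ.sign i) (ℤ.sign j) _ _ ⟩
      signed (ℤ.sign i) (ℤ.∣ i ∣ × 1#) * signed (ℤ.sign j) (ℤ.∣ j ∣ × 1#) ≈⟨ *-cong (fromℤ-signAbs i) (fromℤ-signAbs j) ⟨
      fromℤ i * fromℤ j                        ∎
      where s = ℤ.sign i Sign.* ℤ.sign j

    fromℤ-neg : ∀ i → fromℤ (ℤ.- i) ≈ - fromℤ i
    fromℤ-neg (+ zero)  = sym ε⁻¹≈ε
    fromℤ-neg (+ suc n) = refl
    fromℤ-neg -[1+ n ]  = sym (⁻¹-involutive _)

    fromℤ-morphism : ℤ.+-*-rawRing -Raw-AlmostCommutative⟶ fromCommutativeRing R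
    fromℤ-morphism = record
      { ⟦_⟧ = fromℤ ; +-homo = fromℤ-+ ; *-homo = fromℤ-* ; -‿homo = fromℤ-neg
      ; 0-homo = refl ; 1-homo = refl }

    fromℤ-≟ : ∀ i j → Maybe (fromℤ i ≈ fromℤ j)
    fromℤ-≟ i j with i ℤ.≟ j
    ... | yes ≡.refl = just refl
    ... | no _       = nothing

  open import Algebra.Solver.Ring ℤ.+-*-rawRing (fromCommutativeRing R) fromℤ-morphism fromℤ-≟ public

module RingProperties {c ℓ : Level} (R : CommutativeRing c ℓ) where
  open CommutativeRing R
  open import Algebra.Properties.Group +-group using (ε⁻¹≈ε; ⁻¹-anti-homo-∙)
  open import Algebra.Properties.Semiring.Exp semiring using (_^_)
  open import Algebra.Properties.CommutativeMonoid.Sum +-commutativeMonoid public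
  open import Algebra.Properties.Semiring.Sum semiring using (*-distribˡ-sum; *-distribʳ-sum) public
  open import Relation.Binary.Reasoning.Setoid setoid

  sum-0 : ∀ {k} {f : Fin k → Carrier} → (∀ i → f i ≈ 0#) → sum f ≈ 0#
  sum-0 {k} f≈0 = trans (sum-cong-≋ f≈0) (sum-replicate-zero k)

  sum-neg : ∀ {k} (f : Fin k → Carrier) → sum (λ i → - f i) ≈ - sum f
  sum-neg {zero}  f = sym ε⁻¹≈ε
  sum-neg {suc k} f = trans (+-congˡ (sum-neg (λ i → f (Fin.suc i)))) (trans (+-comm _ _) (sym (⁻¹-anti-homo-∙ _ _)))

  sum-sub : ∀ {k} (f g : Fin k → Carrier) → sum (λ i → f i - g i) ≈ sum f - sum g
  sum-sub f g = trans (∑-distrib-+ f (λ i → - g i)) (+-congˡ (sum-neg g))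

  sum-*-sum-comm : ∀ {m k} (c : Fin m → Carrier) (a : Fin m → Fin k → Carrier) (b : Fin k → Carrier) →
                   sum (λ i → c i * sum (λ j → a i j * b j)) ≈ sum (λ j → sum (λ i → c i * a i j) * b j)
  sum-*-sum-comm {m} {k} c a b = begin
    sum (λ i → c i * sum (λ j → a i j * b j))    ≈⟨ sum-cong-≋ {m} (λ i → *-distribˡ-sum (c i) (λ j → a i j * b j)) ⟩
    sum (λ i → sum (λ j → c i * (a i j * b j)))  ≈⟨ sum-cong-≋ {m} (λ i → sum-cong-≋ {k} (λ j → sym (*-assoc (c i) (a i j) (b j)))) ⟩
    sum (λ i → sum (λ j → c i * a i j * b j))    ≈⟨ ∑-comm (λ i j → c i * a i j * b j) ⟩
    sum (λ j → sum (λ i → c i * a i j * b j))    ≈⟨ sum-cong-≋ {k} (λ j → *-distribʳ-sum (b j) (λ i → c i * a i j)) ⟨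
    sum (λ j → sum (λ i → c i * a i j) * b j)    ∎

  sum-single : ∀ {k} {f : Fin k → Carrier} (j : Fin k) → (∀ i → i ≢ j → f i ≈ 0#) → sum f ≈ f j
  sum-single {suc k} Fin.zero    f≈0 = trans (+-congˡ (sum-0 λ i → f≈0 (Fin.suc i) λ ())) (+-identityʳ _)
  sum-single {suc k} (Fin.suc j) f≈0 =
    trans (+-cong (f≈0 Fin.zero λ ()) (sum-single j λ i i≢j → f≈0 (Fin.suc i) (i≢j ∘ Fin.suc-injective))) (+-identityˡ _)

  𝟙 : Bool → Carrier
  𝟙 true  = 1#
  𝟙 false = 0#

  sum-𝟙δ : ∀ {k} (a : Fin k) (f : Fin k → Carrier) → sum (λ j → 𝟙 (δ a j) * f j) ≈ f a
  sum-𝟙δ a f = trans (sum-single a 𝟙δ≈0) 𝟙δ≈1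
    where
    𝟙δ≈0 : ∀ j → j ≢ a → 𝟙 (δ a j) * f j ≈ 0#
    𝟙δ≈0 j j≢a with a Fin.≟ j
    ... | yes a≡j = contradiction (≡.sym a≡j) j≢a
    ... | no  _   = zeroˡ (f j)
    𝟙δ≈1 : 𝟙 (δ a a) * f a ≈ f a
    𝟙δ≈1 with a Fin.≟ a
    ... | yes _   = *-identityˡ (f a)
    ... | no  a≢a = contradiction ≡.refl a≢a

  1#^ : ∀ t → 1# ^ t ≈ 1#
  1#^ zero    = refl
  1#^ (suc t) = trans (*-identityˡ _) (1#^ t)

  x-0≈x : ∀ x → x - 0# ≈ x
  x-0≈x x = trans (+-congˡ ε⁻¹≈ε) (+-identityʳ x)

module FieldProperties {c ℓ : Level} (L : CommutativeRing c ℓ) (isField : FieldDefs.IsField L)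
                       (_≟_ : Decidable (CommutativeRing._≈_ L)) where
  open CommutativeRing L
  open import Algebra.Properties.Semiring.Exp semiring using (_^_)
  open import Algebra.Properties.Group +-group using (ε⁻¹≈ε; ⁻¹-involutive)
  open import Algebra.Properties.AbelianGroup +-abelianGroup using (⁻¹-∙-comm)
  open RingProperties L using (𝟙; x-0≈x)
  open import Relation.Binary.Reasoning.Setoid setoid

  1≉0 : 1# ≉ 0#
  1≉0 1≈0 = proj₁ isField (sym 1≈0)

  x*y≈0⇒y≈0 : ∀ {x y} → x ≉ 0# → x * y ≈ 0# → y ≈ 0#
  x*y≈0⇒y≈0 {x} {y} x≉0 xy≈0 = begin
    y              ≈⟨ *-identityˡ y ⟨
    1# * y         ≈⟨ *-congʳ (trans (sym (proj₂ (proj₂ isField x x≉0))) (*-comm x x⁻¹)) ⟩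
    (x⁻¹ * x) * y  ≈⟨ *-assoc x⁻¹ x y ⟩
    x⁻¹ * (x * y)  ≈⟨ *-congˡ xy≈0 ⟩
    x⁻¹ * 0#       ≈⟨ zeroʳ x⁻¹ ⟩
    0#             ∎
    where x⁻¹ = proj₁ (proj₂ isField x x≉0)

  x*y≈0⇒x≈0∨y≈0 : ∀ {x y} → x * y ≈ 0# → x ≈ 0# ⊎ y ≈ 0#
  x*y≈0⇒x≈0∨y≈0 {x} xy≈0 with x ≟ 0#
  ... | yes x≈0 = inj₁ x≈0
  ... | no  x≉0 = inj₂ (x*y≈0⇒y≈0 x≉0 xy≈0)

  x^k≈0⇒x≈0 : ∀ {x} k → x ^ k ≈ 0# → x ≈ 0#
  x^k≈0⇒x≈0 zero    1≈0    = contradiction 1≈0 1≉0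
  x^k≈0⇒x≈0 (suc k) xxᵏ≈0 with x*y≈0⇒x≈0∨y≈0 xxᵏ≈0
  ... | inj₁ x≈0  = x≈0
  ... | inj₂ xᵏ≈0 = x^k≈0⇒x≈0 k xᵏ≈0

  -- This is the summand of nonzeroCount, which therefore unfolds to a double sum of nz.
  nz : Carrier → ℕ
  nz x = if does (x ≟ 0#) then 0 else 1

  nz-cong : ∀ {x y} → x ≈ y → nz x ≡ nz y
  nz-cong {x} {y} x≈y with x ≟ 0# | y ≟ 0#
  ... | yes _   | yes _   = ≡.refl
  ... | no  _   | no  _   = ≡.refl
  ... | yes x≈0 | no  y≉0 = contradiction (trans (sym x≈y) x≈0) y≉0
  ... | no  x≉0 | yes y≈0 = contradiction (trans x≈y y≈0) x≉0

  nz-0# : nz 0# ≡ 0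
  nz-0# with 0# ≟ 0#
  ... | yes _  = ≡.refl
  ... | no 0≉0 = contradiction refl 0≉0

  nz-1# : nz 1# ≡ 1
  nz-1# with 1# ≟ 0#
  ... | yes 1≈0 = contradiction 1≈0 1≉0
  ... | no  _   = ≡.refl

  nz-‿ : ∀ x → nz (- x) ≡ nz x
  nz-‿ x with (- x) ≟ 0# | x ≟ 0#
  ... | yes _    | yes _   = ≡.refl
  ... | no  _    | no  _   = ≡.refl
  ... | yes -x≈0 | no  x≉0 = contradiction (trans (sym (⁻¹-involutive x)) (trans (-‿cong -x≈0) ε⁻¹≈ε)) x≉0
  ... | no -x≉0  | yes x≈0 = contradiction (trans (-‿cong x≈0) ε⁻¹≈ε) -x≉0

  nz-*ˡ : ∀ {u} x → u ≉ 0# → nz (u * x) ≡ nz x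
  nz-*ˡ {u} x u≉0 with (u * x) ≟ 0# | x ≟ 0#
  ... | yes _    | yes _   = ≡.refl
  ... | no  _    | no  _   = ≡.refl
  ... | yes ux≈0 | no  x≉0 = contradiction (x*y≈0⇒y≈0 u≉0 ux≈0) x≉0
  ... | no  ux≉0 | yes x≈0 = contradiction (trans (*-congˡ x≈0) (zeroʳ u)) ux≉0

  nz-𝟙-𝟙-𝟙 : ∀ x y z → nz (𝟙 x - 𝟙 y - 𝟙 z) ≡ tally (nz (1# + 1#)) x y z
  nz-𝟙-𝟙-𝟙 false false false = ≡.trans (nz-cong (trans (x-0≈x _) (x-0≈x _))) nz-0#
  nz-𝟙-𝟙-𝟙 true  false false = ≡.trans (nz-cong (trans (x-0≈x _) (x-0≈x _))) nz-1#
  nz-𝟙-𝟙-𝟙 false true  false = ≡.trans (nz-cong (trans (x-0≈x _) (+-identityˡ _))) (≡.trans (nz-‿ 1#) nz-1#)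
  nz-𝟙-𝟙-𝟙 false false true  = ≡.trans (nz-cong (trans (+-congʳ (x-0≈x 0#)) (+-identityˡ _))) (≡.trans (nz-‿ 1#) nz-1#)
  nz-𝟙-𝟙-𝟙 true  true  false = ≡.trans (nz-cong (trans (x-0≈x _) (-‿inverseʳ 1#))) nz-0#
  nz-𝟙-𝟙-𝟙 true  false true  = ≡.trans (nz-cong (trans (+-congʳ (x-0≈x 1#)) (-‿inverseʳ 1#))) nz-0#
  nz-𝟙-𝟙-𝟙 false true  true  = ≡.trans (nz-cong (trans (+-congʳ (+-identityˡ _)) (⁻¹-∙-comm 1# 1#))) (nz-‿ (1# + 1#))
  nz-𝟙-𝟙-𝟙 true  true  true  = ≡.trans (nz-cong (trans (+-congʳ (-‿inverseʳ 1#)) (+-identityˡ _))) (≡.trans (nz-‿ 1#) nz-1#)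

module Characteristic {c ℓ : Level} (R : CommutativeRing c ℓ) where
  open CommutativeRing R
  open FieldDefs R using (HasCardinality)
  open RingProperties R using (sum; ∑-permute; sum-cong-≋; ∑-distrib-+; sum-replicate; sum-init-last; sum-0)
  open import Algebra.Properties.Group +-group using (//-rightDividesˡ; //-rightDividesʳ; identityʳ-unique)
  open import Algebra.Properties.Semiring.Mult semiring using (_×_; ×-congʳ; ×-assoc-*; ×1-homo-*)
  open import Algebra.Properties.Semiring.Exp semiring using (_^_)
  open import Algebra.Properties.CommutativeSemiring.Binomial commutativeSemiring using (theorem; binomialTerm)
  open import Relation.Binary.Reasoning.Setoid setoid

  -- Translation by 1# permutes the finitely many elements, so it leaves their sum unchanged.
  cardinality×1≈0 : ∀ N → HasCardinality N → N × 1# ≈ 0#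
  cardinality×1≈0 N (e , e-inj , e-onto) = identityʳ-unique (sum e) (N × 1#) (sym (begin
      sum e                       ≈⟨ ∑-permute e (permutation shift unshift unshift-shift shift-unshift) ⟩
      sum (λ i → e (shift i))     ≈⟨ sum-cong-≋ (λ i → proj₂ (e-onto (e i + 1#))) ⟩
      sum (λ i → e i + 1#)        ≈⟨ ∑-distrib-+ e (λ _ → 1#) ⟩
      sum e + sum {N} (λ _ → 1#)  ≈⟨ +-congˡ (sum-replicate N) ⟩
      sum e + N × 1#              ∎))
    where
    shift unshift : Fin N → Fin N
    shift i   = proj₁ (e-onto (e i + 1#))
    unshift i = proj₁ (e-onto (e i - 1#))
    unshift-shift : ∀ i → shift (unshift i) ≡ i
    unshift-shift i = e-inj _ _ (trans (proj₂ (e-onto _)) (trans (+-congʳ (proj₂ (e-onto _))) (//-rightDividesˡ 1# (e i))))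
    shift-unshift : ∀ i → unshift (shift i) ≡ i
    shift-unshift i = e-inj _ _ (trans (proj₂ (e-onto _)) (trans (+-congʳ (proj₂ (e-onto _))) (//-rightDividesʳ 1# (e i))))

  ∣⇒×≈0 : ∀ {P C} → P × 1# ≈ 0# → P ∣ C → ∀ x → C × x ≈ 0#
  ∣⇒×≈0 {P} P≈0 (divides c ≡.refl) x = begin
    (c ℕ.* P) × x              ≈⟨ ×-congʳ (c ℕ.* P) (*-identityˡ x) ⟨
    (c ℕ.* P) × (1# * x)       ≈⟨ ×-assoc-* (c ℕ.* P) 1# x ⟨
    ((c ℕ.* P) × 1#) * x       ≈⟨ *-congʳ (trans (×1-homo-* c P) (trans (*-congˡ P≈0) (zeroʳ _))) ⟩
    0# * x                     ≈⟨ zeroˡ x ⟩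
    0#                         ∎

  ^-×1-homo : ∀ a j → (a ℕ.^ j) × 1# ≈ (a × 1#) ^ j
  ^-×1-homo a zero    = +-identityʳ 1#
  ^-×1-homo a (suc j) = trans (×1-homo-* a (a ℕ.^ j)) (*-congˡ (^-×1-homo a j))

  -- In the binomial expansion of (x + y) ^ p only the outer terms survive.
  frobenius : ∀ {p} → Prime p → p × 1# ≈ 0# → ∀ x y → (x + y) ^ p ≈ x ^ p + y ^ p
  frobenius {suc p} pr p≈0 x y = begin
    (x + y) ^ suc p                                        ≈⟨ theorem (suc p) x y ⟩
    term Fin.zero + sum (λ k → term (Fin.suc k))           ≈⟨ +-congˡ (sum-init-last {p} (λ k → term (Fin.suc k))) ⟩
    term Fin.zero + (sum (λ k → term (Fin.suc (Fin.inject₁ k))) + term (Fin.suc (Fin.fromℕ p)))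
                                                           ≈⟨ +-cong first (+-cong (sum-0 middle) last) ⟩
    y ^ suc p + (0# + x ^ suc p)                           ≈⟨ trans (+-congˡ (+-identityˡ _)) (+-comm _ _) ⟩
    x ^ suc p + y ^ suc p                                  ∎
    where
    term = binomialTerm x y (suc p)
    first : term Fin.zero ≈ y ^ suc p
    first = trans (+-identityʳ _) (*-identityˡ _)
    middle : ∀ k → term (Fin.suc (Fin.inject₁ k)) ≈ 0#
    middle k = ∣⇒×≈0 p≈0 (prime∣C pr (suc (toℕ (Fin.inject₁ k))) (ℕ.s≤s ℕ.z≤n)
                 (ℕ.s≤s (≡.subst (ℕ._< p) (≡.sym (Fin.toℕ-inject₁ k)) (Fin.toℕ<n k)))) _
    last : term (Fin.suc (Fin.fromℕ p)) ≈ x ^ suc p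
    last = begin
      term (Fin.suc (Fin.fromℕ p))               ≡⟨ ≡.cong (λ t → (suc p C suc t) × (x ^ suc t * y ^ (p ℕ.∸ t))) (Fin.toℕ-fromℕ p) ⟩
      (suc p C suc p) × (x ^ suc p * y ^ (p ℕ.∸ p)) ≡⟨ ≡.cong₂ (λ c t → c × (x ^ suc p * y ^ t)) (nCn≡1 (suc p)) (ℕ.n∸n≡0 p) ⟩
      1 × (x ^ suc p * 1#)                        ≈⟨ +-identityʳ _ ⟩
      x ^ suc p * 1#                              ≈⟨ *-identityʳ _ ⟩
      x ^ suc p                                   ∎

module FiniteField {c ℓ : Level} (L : CommutativeRing c ℓ) (isField : FieldDefs.IsField L)
                   (_≟_ : Decidable (CommutativeRing._≈_ L))
                   (q n : ℕ) (q-primePower : IsPrimePower q) (card : FieldDefs.HasCardinality L (q ℕ.^ n)) where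
  open CommutativeRing L
  open FieldDefs L using (InBaseField)
  open FieldProperties L isField _≟_ using (1≉0; x^k≈0⇒x≈0)
  open RingProperties L using (1#^)
  open Characteristic L using (cardinality×1≈0; frobenius; ^-×1-homo)
  open import Algebra.Properties.Group +-group using (inverseʳ-unique)
  open import Algebra.Properties.Semiring.Mult semiring using (_×_; ×1-homo-*)
  open import Algebra.Properties.Semiring.Exp semiring using (_^_; ^-congˡ; ^-assocʳ)
  open import Algebra.Properties.CommutativeSemiring.Exp commutativeSemiring using (^-distrib-*)
  open import Relation.Binary.Reasoning.Setoid setoid

  private
    p = proj₁ q-primePower
    k = proj₁ (proj₂ q-primePower)
    p-prime : Prime p
    p-prime = proj₁ (proj₂ (proj₂ q-primePower))
    1≤k = proj₁ (proj₂ (proj₂ (proj₂ q-primePower)))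
    q≡pᵏ : q ≡ p ℕ.^ k
    q≡pᵏ = proj₂ (proj₂ (proj₂ (proj₂ q-primePower)))

  p×1≈0 : p × 1# ≈ 0#
  p×1≈0 = x^k≈0⇒x≈0 (k ℕ.* n) (begin
    (p × 1#) ^ (k ℕ.* n)     ≈⟨ ^-×1-homo p (k ℕ.* n) ⟨
    (p ℕ.^ (k ℕ.* n)) × 1#  ≡⟨ ≡.cong (_× 1#) (≡.trans (≡.sym (ℕ.^-*-assoc p k n)) (≡.cong (ℕ._^ n) (≡.sym q≡pᵏ))) ⟩
    (q ℕ.^ n) × 1#          ≈⟨ cardinality×1≈0 (q ℕ.^ n) card ⟩
    0#                      ∎)

  frobenius-p^ : ∀ r x y → (x + y) ^ (p ℕ.^ r) ≈ x ^ (p ℕ.^ r) + y ^ (p ℕ.^ r)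
  frobenius-p^ zero    x y = trans (*-identityʳ _) (sym (+-cong (*-identityʳ x) (*-identityʳ y)))
  frobenius-p^ (suc r) x y = begin
    (x + y) ^ (p ℕ.* p ℕ.^ r)                   ≈⟨ ^-assocʳ (x + y) p (p ℕ.^ r) ⟨
    ((x + y) ^ p) ^ (p ℕ.^ r)                   ≈⟨ ^-congˡ (p ℕ.^ r) (frobenius p-prime p×1≈0 x y) ⟩
    (x ^ p + y ^ p) ^ (p ℕ.^ r)                 ≈⟨ frobenius-p^ r (x ^ p) (y ^ p) ⟩
    (x ^ p) ^ (p ℕ.^ r) + (y ^ p) ^ (p ℕ.^ r)   ≈⟨ +-cong (^-assocʳ x p (p ℕ.^ r)) (^-assocʳ y p (p ℕ.^ r)) ⟩
    x ^ (p ℕ.* p ℕ.^ r) + y ^ (p ℕ.* p ℕ.^ r)   ∎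

  frobenius-q : ∀ x y → (x + y) ^ q ≈ x ^ q + y ^ q
  frobenius-q x y = ≡.subst (λ t → (x + y) ^ t ≈ x ^ t + y ^ t) (≡.sym q≡pᵏ) (frobenius-p^ k x y)

  instance
    q-nonZero : ℕ.NonZero q
    q-nonZero = ℕ.>-nonZero (≡.subst (0 ℕ.<_) (≡.sym q≡pᵏ) (ℕ.m^n>0 p {{prime⇒nonZero p-prime}} k))

  0#^-nonZero : ∀ t .{{_ : ℕ.NonZero t}} → 0# ^ t ≈ 0#
  0#^-nonZero (suc t) = zeroˡ _

  inBaseField-0# : InBaseField q 0#
  inBaseField-0# = 0#^-nonZero q

  inBaseField-1# : InBaseField q 1#
  inBaseField-1# = 1#^ q

  inBaseField-+ : ∀ {x y} → InBaseField q x → InBaseField q y → InBaseField q (x + y)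
  inBaseField-+ xᵠ≈x yᵠ≈y = trans (frobenius-q _ _) (+-cong xᵠ≈x yᵠ≈y)

  inBaseField-‿ : ∀ {x} → InBaseField q x → InBaseField q (- x)
  inBaseField-‿ {x} xᵠ≈x = inverseʳ-unique x ((- x) ^ q) (begin
    x + (- x) ^ q        ≈⟨ +-congʳ xᵠ≈x ⟨
    x ^ q + (- x) ^ q    ≈⟨ frobenius-q x (- x) ⟨
    (x - x) ^ q          ≈⟨ ^-congˡ q (-‿inverseʳ x) ⟩
    0# ^ q               ≈⟨ inBaseField-0# ⟩
    0#                   ∎)

  inBaseField-* : ∀ {x y} → InBaseField q x → InBaseField q y → InBaseField q (x * y)
  inBaseField-* xᵠ≈x yᵠ≈y = trans (^-distrib-* _ _ q) (*-cong xᵠ≈x yᵠ≈y)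

  inBaseField-×1 : ∀ t → InBaseField q (t × 1#)
  inBaseField-×1 zero    = inBaseField-0#
  inBaseField-×1 (suc t) = inBaseField-+ inBaseField-1# (inBaseField-×1 t)

  inBaseField-inverse : ∀ {x y} → InBaseField q x → x * y ≈ 1# → InBaseField q y
  inBaseField-inverse {x} {y} xᵠ≈x xy≈1 = begin
    y ^ q                  ≈⟨ *-identityˡ _ ⟨
    1# * y ^ q             ≈⟨ *-congʳ (trans (sym xy≈1) (*-comm x y)) ⟩
    (y * x) * y ^ q        ≈⟨ *-assoc y x _ ⟩
    y * (x * y ^ q)        ≈⟨ *-congˡ (*-congʳ xᵠ≈x) ⟨
    y * (x ^ q * y ^ q)    ≈⟨ *-congˡ (^-distrib-* x y q) ⟨
    y * (x * y) ^ q        ≈⟨ *-congˡ (trans (^-congˡ q xy≈1) (1#^ q)) ⟩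
    y * 1#                 ≈⟨ *-identityʳ y ⟩
    y                      ∎

  2∣q⇒1+1≈0 : 2 ∣ q → 1# + 1# ≈ 0#
  2∣q⇒1+1≈0 2∣q with prime⇒irreducible p-prime (prime∣^⇒∣ p k prime[2] (≡.subst (2 ∣_) q≡pᵏ 2∣q))
  ... | inj₂ 2≡p = trans (+-congˡ (sym (+-identityʳ 1#))) (≡.subst (λ t → t × 1# ≈ 0#) (≡.sym 2≡p) p×1≈0)

  -- p is odd, so p × 1# ≈ 1# + (p / 2) × (1# + 1#).
  ¬2∣q⇒1+1≉0 : ¬ 2 ∣ q → 1# + 1# ≉ 0#
  ¬2∣q⇒1+1≉0 2∤q 1+1≈0 = 1≉0 (begin
    1#                                 ≈⟨ +-identityʳ 1# ⟨
    1# + 0#                            ≈⟨ +-congˡ (trans (*-congˡ 2×1≈0) (zeroʳ _)) ⟨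
    1# + ((p / 2) × 1#) * (2 × 1#)     ≈⟨ +-congˡ (×1-homo-* (p / 2) 2) ⟨
    (1 ℕ.+ (p / 2) ℕ.* 2) × 1#         ≡⟨ ≡.cong (_× 1#) p≡1+[p/2]*2 ⟨
    p × 1#                             ≈⟨ p×1≈0 ⟩
    0#                                 ∎)
    where
    2×1≈0 : 2 × 1# ≈ 0#
    2×1≈0 = trans (+-congˡ (+-identityʳ 1#)) 1+1≈0
    r<2∧r≢0⇒r≡1 : ∀ {r} → r ℕ.< 2 → r ≢ 0 → r ≡ 1
    r<2∧r≢0⇒r≡1 {zero}        _                     r≢0 = contradiction ≡.refl r≢0
    r<2∧r≢0⇒r≡1 {suc zero}    _                     _   = ≡.refl
    r<2∧r≢0⇒r≡1 {suc (suc r)} (ℕ.s≤s (ℕ.s≤s ())) _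
    2∤p : ¬ 2 ∣ p
    2∤p 2∣p = 2∤q (∣-trans 2∣p (≡.subst (p ∣_) (≡.sym q≡pᵏ) (p∣pʲ k 1≤k)))
      where
      p∣pʲ : ∀ j → 1 ℕ.≤ j → p ∣ p ℕ.^ j
      p∣pʲ (suc j) _ = m∣m*n (p ℕ.^ j)
    p≡1+[p/2]*2 : p ≡ 1 ℕ.+ (p / 2) ℕ.* 2
    p≡1+[p/2]*2 = ≡.trans (m≡m%n+[m/n]*n p 2)
      (≡.cong (ℕ._+ (p / 2) ℕ.* 2) (r<2∧r≢0⇒r≡1 (m%n<n p 2) (2∤p ∘ m%n≡0⇒n∣m p 2)))

module RootsOfUnity {c ℓ : Level} (L : CommutativeRing c ℓ) (isField : FieldDefs.IsField L)
                    (_≟_ : Decidable (CommutativeRing._≈_ L)) (n : ℕ) (α : CommutativeRing.Carrier L)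
                    (α^[1+n]≈1 : CommutativeRing._≈_ L (FieldDefs._^#_ L α (suc n)) (CommutativeRing.1# L))
                    (α≉1 : ¬ CommutativeRing._≈_ L α (CommutativeRing.1# L)) where
  open CommutativeRing L
  open FieldProperties L isField _≟_ using (x*y≈0⇒y≈0)
  open RingProperties L using (sum; sum-cong-≋; ∑-permute; *-distribˡ-sum; 1#^)
  open RingSolver L using (solve; _:=_; _:+_; _:-_; _:*_; con)
  open import Data.Integer using (+_)
  open import Algebra.Properties.Group +-group using (x∙y⁻¹≈ε⇒x≈y; inverseʳ-unique)
  open import Algebra.Properties.Semiring.Exp semiring using (_^_; ^-congˡ; ^-homo-*; ^-assocʳ)
  open import Relation.Binary.Reasoning.Setoid setoid

  α^[[1+n]*t]≈1 : ∀ t → α ^ (suc n ℕ.* t) ≈ 1#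
  α^[[1+n]*t]≈1 t = trans (sym (^-assocʳ α (suc n) t)) (trans (^-congˡ t α^[1+n]≈1) (1#^ t))

  α^-% : ∀ a → α ^ a ≈ α ^ (a % suc n)
  α^-% a = begin
    α ^ a
      ≡⟨ ≡.cong (α ^_) (≡.trans (m≡m%n+[m/n]*n a (suc n)) (≡.cong (a % suc n ℕ.+_) (ℕ.*-comm (a / suc n) (suc n)))) ⟩
    α ^ (a % suc n ℕ.+ suc n ℕ.* (a / suc n))  ≈⟨ ^-homo-* α (a % suc n) _ ⟩
    α ^ (a % suc n) * α ^ (suc n ℕ.* (a / suc n)) ≈⟨ *-congˡ (α^[[1+n]*t]≈1 (a / suc n)) ⟩
    α ^ (a % suc n) * 1#                       ≈⟨ *-identityʳ _ ⟩
    α ^ (a % suc n)                            ∎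

  α^-%-cong : ∀ {a b} → a % suc n ≡ b % suc n → α ^ a ≈ α ^ b
  α^-%-cong {a} {b} eq = trans (α^-% a) (trans (reflexive (≡.cong (α ^_) eq)) (sym (α^-% b)))

  geometricSum : ∀ r → (α - 1#) * sum {r} (λ k → α ^ toℕ k) ≈ α ^ r - 1#
  geometricSum zero    = trans (zeroʳ _) (sym (-‿inverseʳ 1#))
  geometricSum (suc r) = begin
    (α - 1#) * (1# + sum {r} (λ k → α * α ^ toℕ k)) ≈⟨ *-congˡ (+-congˡ (*-distribˡ-sum {r} α (λ k → α ^ toℕ k))) ⟨
    (α - 1#) * (1# + α * s)
      ≈⟨ solve 2 (λ a s → (a :- con (+ 1)) :* (con (+ 1) :+ a :* s) := (a :- con (+ 1)) :+ a :* ((a :- con (+ 1)) :* s)) refl α s ⟩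
    (α - 1#) + α * ((α - 1#) * s)              ≈⟨ +-congˡ (*-congˡ (geometricSum r)) ⟩
    (α - 1#) + α * (α ^ r - 1#)
      ≈⟨ solve 2 (λ a b → (a :- con (+ 1)) :+ a :* (b :- con (+ 1)) := a :* b :- con (+ 1)) refl α (α ^ r) ⟩
    α * α ^ r - 1#                             ∎
    where s = sum {r} (λ k → α ^ toℕ k)

  ∑α^[1+j]≈-1 : sum {n} (λ j → α ^ suc (toℕ j)) ≈ - 1#
  ∑α^[1+j]≈-1 = inverseʳ-unique 1# _ (x*y≈0⇒y≈0 α-1≉0 (begin
    (α - 1#) * sum {suc n} (λ k → α ^ toℕ k)  ≈⟨ geometricSum (suc n) ⟩
    α ^ suc n - 1#                            ≈⟨ +-congʳ α^[1+n]≈1 ⟩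
    1# - 1#                                   ≈⟨ -‿inverseʳ 1# ⟩
    0#                                        ∎))
    where
    α-1≉0 : α - 1# ≉ 0#
    α-1≉0 = α≉1 ∘ x∙y⁻¹≈ε⇒x≈y α 1#

  -- e q^i runs through the nonzero residues, so these are all the (n+1)-th roots of unity other than 1.
  orbitSum : ∀ {q e} → Prime (suc n) → IsPrimitiveRootMod q (suc n) → ¬ suc n ∣ e →
             sum {n} (λ i → α ^ (e ℕ.* q ℕ.^ toℕ i)) ≈ - 1#
  orbitSum {q} {e} n+1-prime q-primitive ∤e = begin
    sum {n} (λ i → α ^ (e ℕ.* q ℕ.^ toℕ i))
      ≈⟨ sum-cong-≋ (λ i → trans (α^-% (e ℕ.* q ℕ.^ toℕ i)) (reflexive (≡.cong (α ^_) (≡.sym (orbit-spec ∤e i))))) ⟩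
    sum {n} (λ i → α ^ suc (toℕ (orbit ∤e i)))
      ≈⟨ ∑-permute (λ j → α ^ suc (toℕ j)) (proj₁ (injective⇒permutation (orbit-injective ∤e))) ⟨
    sum {n} (λ j → α ^ suc (toℕ j))             ≈⟨ ∑α^[1+j]≈-1 ⟩
    - 1#                                        ∎
    where open PowersOfPrimitiveRoot n q n+1-prime q-primitive using (orbit; orbit-spec; orbit-injective)

module DualBasis {c ℓ : Level} (L : CommutativeRing c ℓ) (isField : FieldDefs.IsField L)
                 (_≟_ : Decidable (CommutativeRing._≈_ L)) (n q : ℕ)
                 (n+1-prime : Prime (suc n)) (q-primitive : IsPrimitiveRootMod q (suc n))
                 (α : CommutativeRing.Carrier L)
                 (α^[1+n]≈1 : CommutativeRing._≈_ L (FieldDefs._^#_ L α (suc n)) (CommutativeRing.1# L))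
                 (α≉1 : ¬ CommutativeRing._≈_ L α (CommutativeRing.1# L))
                 (β : CommutativeRing.Carrier L) (β-dual : FieldDefs.IsDualNormalGenerator L q n α β) where
  open CommutativeRing L
  open FieldDefs L using (Tr; conj)
  open RingProperties L using (sum; sum-cong-≋; sum-replicate; sum-sub; sum-single; sum-*-sum-comm)
  open RingSolver L using (solve; _:=_; _:-_; _:*_; con)
  open import Data.Integer using (+_)
  open RootsOfUnity L isField _≟_ n α α^[1+n]≈1 α≉1 using (α^[[1+n]*t]≈1; orbitSum)
  open PowersOfPrimitiveRoot n q n+1-prime q-primitive using (1≤n; ∤q^; ∤n+q^)
  open import Algebra.Properties.Semiring.Mult semiring using (_×_)
  open import Algebra.Properties.Group +-group using (⁻¹-involutive; x∙y⁻¹≈ε⇒x≈y)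
  open import Algebra.Properties.Semiring.Exp semiring using (_^_; ^-homo-*; ^-assocʳ)
  open import Algebra.Properties.CommutativeSemiring.Exp commutativeSemiring using (^-distrib-*)
  open import Relation.Binary.Reasoning.Setoid setoid

  β⟨_⟩ : Fin n → Carrier
  β⟨ j ⟩ = conj q β (toℕ j)

  -- α ^ n is α⁻¹, so ᾱ j is the inverse of the conjugate α ^ (q ^ j).
  ᾱ : Fin n → Carrier
  ᾱ j = α ^ (n ℕ.* q ℕ.^ toℕ j)

  M : Carrier
  M = suc n × 1#

  Tr-expand : ∀ (i j : Fin n) → Tr q n (conj q α (toℕ i) * conj q β (toℕ j)) ≈
                      sum {n} (λ k → α ^ (q ℕ.^ toℕ i ℕ.* q ℕ.^ toℕ k) * β ^ (q ℕ.^ toℕ j ℕ.* q ℕ.^ toℕ k))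
  Tr-expand i j = sum-cong-≋ {n} λ k → trans (^-distrib-* (α ^ (q ℕ.^ toℕ i)) (β ^ (q ℕ.^ toℕ j)) (q ℕ.^ toℕ k))
    (*-cong (^-assocʳ α (q ℕ.^ toℕ i) (q ℕ.^ toℕ k)) (^-assocʳ β (q ℕ.^ toℕ j) (q ℕ.^ toℕ k)))

  twistedSum : Fin n → Carrier
  twistedSum k = sum {n} (λ i → (ᾱ i - 1#) * α ^ (q ℕ.^ toℕ i ℕ.* q ℕ.^ toℕ k))

  twistedSum-split : ∀ k → twistedSum k ≈ sum {n} (λ i → α ^ ((n ℕ.+ q ℕ.^ toℕ k) ℕ.* q ℕ.^ toℕ i))
                                         - sum {n} (λ i → α ^ (q ℕ.^ toℕ k ℕ.* q ℕ.^ toℕ i))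
  twistedSum-split k = trans (sum-cong-≋ {n} term) (sum-sub {n} _ _)
    where
    term : ∀ i → (ᾱ i - 1#) * α ^ (q ℕ.^ toℕ i ℕ.* q ℕ.^ toℕ k) ≈
                 α ^ ((n ℕ.+ q ℕ.^ toℕ k) ℕ.* q ℕ.^ toℕ i) - α ^ (q ℕ.^ toℕ k ℕ.* q ℕ.^ toℕ i)
    term i = begin
      (α ^ (n ℕ.* Qi) - 1#) * α ^ (Qi ℕ.* Qk)          ≈⟨ solve 2 (λ a b → (a :- con (+ 1)) :* b := a :* b :- b) refl _ _ ⟩
      α ^ (n ℕ.* Qi) * α ^ (Qi ℕ.* Qk) - α ^ (Qi ℕ.* Qk) ≈⟨ +-congʳ (^-homo-* α (n ℕ.* Qi) (Qi ℕ.* Qk)) ⟨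
      α ^ (n ℕ.* Qi ℕ.+ Qi ℕ.* Qk) - α ^ (Qi ℕ.* Qk)    ≡⟨ ≡.cong₂ (λ u v → α ^ u - α ^ v) exponent (ℕ.*-comm Qi Qk) ⟩
      α ^ ((n ℕ.+ Qk) ℕ.* Qi) - α ^ (Qk ℕ.* Qi)          ∎
      where
      Qi = q ℕ.^ toℕ i
      Qk = q ℕ.^ toℕ k
      exponent : n ℕ.* Qi ℕ.+ Qi ℕ.* Qk ≡ (n ℕ.+ Qk) ℕ.* Qi
      exponent = ≡.trans (≡.cong (n ℕ.* Qi ℕ.+_) (ℕ.*-comm Qi Qk)) (≡.sym (ℕ.*-distribʳ-+ Qi n Qk))

  twistedSum-first : ∀ {k} → toℕ k ≡ 0 → twistedSum k ≈ M
  twistedSum-first {k} k≡0 = begin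
    twistedSum k                                                          ≈⟨ twistedSum-split k ⟩
    sum {n} (λ i → α ^ ((n ℕ.+ q ℕ.^ toℕ k) ℕ.* q ℕ.^ toℕ i)) - sum {n} (λ i → α ^ (q ℕ.^ toℕ k ℕ.* q ℕ.^ toℕ i))
      ≡⟨ ≡.cong (λ t → sum {n} (λ i → α ^ ((n ℕ.+ q ℕ.^ t) ℕ.* q ℕ.^ toℕ i)) - sum {n} (λ i → α ^ (q ℕ.^ t ℕ.* q ℕ.^ toℕ i))) k≡0 ⟩
    sum {n} (λ i → α ^ ((n ℕ.+ 1) ℕ.* q ℕ.^ toℕ i)) - sum {n} (λ i → α ^ (1 ℕ.* q ℕ.^ toℕ i))
      ≈⟨ +-cong (trans (sum-cong-≋ {n} each≈1) (sum-replicate n)) (-‿cong (orbitSum n+1-prime q-primitive (∤q^ 0))) ⟩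
    n × 1# - - 1#                                                         ≈⟨ trans (+-congˡ (⁻¹-involutive 1#)) (+-comm _ _) ⟩
    suc n × 1#                                                            ∎
    where
    each≈1 : ∀ i → α ^ ((n ℕ.+ 1) ℕ.* q ℕ.^ toℕ i) ≈ 1#
    each≈1 i = trans (reflexive (≡.cong (λ u → α ^ (u ℕ.* q ℕ.^ toℕ i)) (ℕ.+-comm n 1))) (α^[[1+n]*t]≈1 (q ℕ.^ toℕ i))

  twistedSum-rest : ∀ {k} → toℕ k ≢ 0 → twistedSum k ≈ 0#
  twistedSum-rest {k} k≢0 = begin
    twistedSum k                                                          ≈⟨ twistedSum-split k ⟩
    sum {n} (λ i → α ^ ((n ℕ.+ q ℕ.^ toℕ k) ℕ.* q ℕ.^ toℕ i)) - sum {n} (λ i → α ^ (q ℕ.^ toℕ k ℕ.* q ℕ.^ toℕ i))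
      ≈⟨ +-cong (orbitSum n+1-prime q-primitive (∤n+q^ (toℕ k) (ℕ.n≢0⇒n>0 k≢0) (Fin.toℕ<n k)))
                (-‿cong (orbitSum n+1-prime q-primitive (∤q^ (toℕ k)))) ⟩
    - 1# - - 1#                                                           ≈⟨ -‿inverseʳ (- 1#) ⟩
    0#                                                                    ∎

  first : Fin n
  first = Fin.fromℕ< 1≤n

  toℕ-first : toℕ first ≡ 0
  toℕ-first = Fin.toℕ-fromℕ< 1≤n

  toℕ≡0⇒≡first : ∀ {k} → toℕ k ≡ 0 → k ≡ first
  toℕ≡0⇒≡first k≡0 = Fin.toℕ-injective (≡.trans k≡0 (≡.sym toℕ-first))

  ᾱ-first : ᾱ first ≈ α ^ n
  ᾱ-first = reflexive (≡.cong (α ^_) (≡.trans (≡.cong (λ t → n ℕ.* q ℕ.^ t) toℕ-first) (ℕ.*-identityʳ n)))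

  β⟨first⟩≈β : β⟨ first ⟩ ≈ β
  β⟨first⟩≈β = trans (reflexive (≡.cong (λ t → β ^ (q ℕ.^ t)) toℕ-first)) (*-identityʳ β)

  M*β≈ᾱ-1 : ∀ j → M * β⟨ j ⟩ ≈ ᾱ j - 1#
  M*β≈ᾱ-1 j = begin
    M * β⟨ j ⟩                                            ≈⟨ *-cong (sym (twistedSum-first toℕ-first)) (reflexive (≡.cong (β ^_) qʲ≡qʲ*q⁰)) ⟩
    twistedSum first * b first
      ≈⟨ sum-single first (λ k k≢first → trans (*-congʳ (twistedSum-rest (k≢first ∘ toℕ≡0⇒≡first))) (zeroˡ _)) ⟨
    sum {n} (λ k → twistedSum k * b k)                    ≈⟨ sum-*-sum-comm (λ i → ᾱ i - 1#) a b ⟨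
    sum {n} (λ i → (ᾱ i - 1#) * sum {n} (λ k → a i k * b k)) ≈⟨ sum-cong-≋ {n} (λ i → *-congˡ (Tr-expand i j)) ⟨
    sum {n} (λ i → (ᾱ i - 1#) * Tr q n (conj q α (toℕ i) * β⟨ j ⟩))
      ≈⟨ sum-single j (λ i i≢j → trans (*-congˡ (proj₂ (β-dual i j) i≢j)) (zeroʳ _)) ⟩
    (ᾱ j - 1#) * Tr q n (conj q α (toℕ j) * β⟨ j ⟩)       ≈⟨ trans (*-congˡ (proj₁ (β-dual j j) ≡.refl)) (*-identityʳ _) ⟩
    ᾱ j - 1#                                              ∎
    where
    a : Fin n → Fin n → Carrier
    a i k = α ^ (q ℕ.^ toℕ i ℕ.* q ℕ.^ toℕ k)
    b : Fin n → Carrier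
    b k = β ^ (q ℕ.^ toℕ j ℕ.* q ℕ.^ toℕ k)
    qʲ≡qʲ*q⁰ : q ℕ.^ toℕ j ≡ q ℕ.^ toℕ j ℕ.* q ℕ.^ toℕ first
    qʲ≡qʲ*q⁰ = ≡.trans (≡.sym (ℕ.*-identityʳ _)) (≡.cong (λ t → q ℕ.^ toℕ j ℕ.* q ℕ.^ t) (≡.sym toℕ-first))

  -- Otherwise ᾱ first = α ^ n would be 1, and so would α = α ^ (n + 1).
  M≉0 : M ≉ 0#
  M≉0 M≈0 = α≉1 (begin
    α              ≈⟨ *-identityʳ α ⟨
    α * 1#         ≈⟨ *-congˡ (x∙y⁻¹≈ε⇒x≈y _ _ αⁿ-1≈0) ⟨
    α * α ^ n      ≈⟨ α^[1+n]≈1 ⟩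
    1#             ∎)
    where
    αⁿ-1≈0 : α ^ n - 1# ≈ 0#
    αⁿ-1≈0 = begin
      α ^ n - 1#         ≈⟨ +-congʳ ᾱ-first ⟨
      ᾱ first - 1#       ≈⟨ M*β≈ᾱ-1 first ⟨
      M * β⟨ first ⟩     ≈⟨ trans (*-congʳ M≈0) (zeroˡ _) ⟩
      0#                 ∎

  module MultiplicationTable (q-primePower : IsPrimePower q) (card : FieldDefs.HasCardinality L (q ℕ.^ n)) where
    open FieldDefs L using (InBaseField)
    open FieldProperties L isField _≟_
    open RingProperties L using (sum-𝟙δ; sum-0; 𝟙; *-distribˡ-sum)
    open FiniteField L isField _≟_ q n q-primePower card
    open RootsOfUnity L isField _≟_ n α α^[1+n]≈1 α≉1 using (α^-%-cong)
    open PowersOfPrimitiveRoot n q n+1-prime q-primitive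
      using (IsZechLog; ZechView; zech; undefined; zechView; zech≢0; zech≢self; zech⇒≢antipode; antipode; undefined⇒≡antipode)

    μ : Carrier
    μ = proj₁ (proj₂ isField M M≉0)

    M*μ≈1 : M * μ ≈ 1#
    M*μ≈1 = proj₂ (proj₂ isField M M≉0)

    μ≉0 : μ ≉ 0#
    μ≉0 μ≈0 = 1≉0 (trans (sym M*μ≈1) (trans (*-congˡ μ≈0) (zeroʳ M)))

    -- Multiply by M² = μ⁻²: (a - 1)(b - 1) = (ab - 1) - (a - 1) - (b - 1).
    x*y≈μ*[v-x-y] : ∀ {x y a b v} → M * x ≈ a - 1# → M * y ≈ b - 1# → M * v ≈ a * b - 1# →
                    x * y ≈ μ * (v - x - y)
    x*y≈μ*[v-x-y] {x} {y} {a} {b} {v} Mx My Mv = begin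
      x * y                                         ≈⟨ trans (*-congʳ M*μ≈1) (trans (*-identityˡ _) (trans (*-congʳ M*μ≈1) (*-identityˡ _))) ⟨
      (M * μ) * ((M * μ) * (x * y))
        ≈⟨ solve 4 (λ m u x y → (m :* u) :* ((m :* u) :* (x :* y)) := u :* (u :* ((m :* x) :* (m :* y)))) refl M μ x y ⟩
      μ * (μ * ((M * x) * (M * y)))                 ≈⟨ *-congˡ (*-congˡ (*-cong Mx My)) ⟩
      μ * (μ * ((a - 1#) * (b - 1#)))
        ≈⟨ *-congˡ (*-congˡ (solve 2 (λ a b → (a :- con (+ 1)) :* (b :- con (+ 1))
                                            := (a :* b :- con (+ 1)) :- (a :- con (+ 1)) :- (b :- con (+ 1))) refl a b)) ⟩
      μ * (μ * ((a * b - 1#) - (a - 1#) - (b - 1#))) ≈⟨ *-congˡ (*-congˡ (+-cong (+-cong Mv (-‿cong Mx)) (-‿cong My))) ⟨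
      μ * (μ * (M * v - M * x - M * y))
        ≈⟨ solve 5 (λ m u v x y → u :* (u :* (m :* v :- m :* x :- m :* y)) := u :* ((m :* u) :* (v :- x :- y))) refl M μ v x y ⟩
      μ * ((M * μ) * (v - x - y))                   ≈⟨ *-congˡ (trans (*-congʳ M*μ≈1) (*-identityˡ _)) ⟩
      μ * (v - x - y)                               ∎

    ᾱ-first*ᾱ : ∀ i → ᾱ first * ᾱ i ≈ α ^ (n ℕ.* (1 ℕ.+ q ℕ.^ toℕ i))
    ᾱ-first*ᾱ i = begin
      ᾱ first * ᾱ i                        ≈⟨ *-congʳ ᾱ-first ⟩
      α ^ n * ᾱ i                          ≈⟨ ^-homo-* α n _ ⟨
      α ^ (n ℕ.+ n ℕ.* q ℕ.^ toℕ i)         ≡⟨ ≡.cong (λ e → α ^ (e ℕ.+ n ℕ.* q ℕ.^ toℕ i)) (ℕ.*-identityʳ n) ⟨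
      α ^ (n ℕ.* 1 ℕ.+ n ℕ.* q ℕ.^ toℕ i)   ≡⟨ ≡.cong (α ^_) (ℕ.*-distribˡ-+ n 1 (q ℕ.^ toℕ i)) ⟨
      α ^ (n ℕ.* (1 ℕ.+ q ℕ.^ toℕ i))       ∎

    zechVector : ∀ {i} → ZechView i → Fin n → Bool
    zechVector (zech k _)    = δ k
    zechVector (undefined _) = λ _ → false

    zechTerm : ∀ {i} → ZechView i → Carrier
    zechTerm (zech k _)    = β⟨ k ⟩
    zechTerm (undefined _) = 0#

    M*zechTerm : ∀ {i} (v : ZechView i) → M * zechTerm v ≈ ᾱ first * ᾱ i - 1#
    M*zechTerm {i} (zech k eq) = trans (M*β≈ᾱ-1 k) (+-congʳ (sym (trans (ᾱ-first*ᾱ i)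
      (α^-%-cong {n ℕ.* (1 ℕ.+ q ℕ.^ toℕ i)} {n ℕ.* q ℕ.^ toℕ k} (%-≡-*ˡ {suc n} n (≡.sym eq))))))
    M*zechTerm {i} (undefined eq) = begin
      M * 0#                                ≈⟨ zeroʳ M ⟩
      0#                                    ≈⟨ -‿inverseʳ 1# ⟨
      1# - 1#
        ≈⟨ +-congʳ (trans (α^-%-cong {n ℕ.* (1 ℕ.+ q ℕ.^ toℕ i)} {n ℕ.* 0} (%-≡-*ˡ {suc n} n eq))
                          (reflexive (≡.cong (α ^_) (ℕ.*-zeroʳ n)))) ⟨
      α ^ (n ℕ.* (1 ℕ.+ q ℕ.^ toℕ i)) - 1#  ≈⟨ +-congʳ (ᾱ-first*ᾱ i) ⟨
      ᾱ first * ᾱ i - 1#                    ∎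

    β*β⟨i⟩ : ∀ i → β * β⟨ i ⟩ ≈ μ * (zechTerm (zechView i) - β⟨ first ⟩ - β⟨ i ⟩)
    β*β⟨i⟩ i = trans (*-congʳ (sym β⟨first⟩≈β)) (x*y≈μ*[v-x-y] (M*β≈ᾱ-1 first) (M*β≈ᾱ-1 i) (M*zechTerm (zechView i)))

    zech≢first : ∀ {i k} → IsZechLog i k → k ≢ first
    zech≢first {i} {k} eq k≡first = zech≢0 {i} {k} eq (≡.trans (≡.cong toℕ k≡first) toℕ-first)

    t : Fin n → Fin n → Carrier
    t i j = μ * (𝟙 (zechVector (zechView i) j) - 𝟙 (δ first j) - 𝟙 (δ i j))

    sum-zechVector : ∀ {i} (v : ZechView i) → sum {n} (λ j → 𝟙 (zechVector v j) * β⟨ j ⟩) ≈ zechTerm v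
    sum-zechVector (zech k _)    = sum-𝟙δ k β⟨_⟩
    sum-zechVector (undefined _) = sum-0 (λ j → zeroˡ β⟨ j ⟩)

    t-row : ∀ i → β * β⟨ i ⟩ ≈ sum {n} (λ j → t i j * β⟨ j ⟩)
    t-row i = trans (β*β⟨i⟩ i) (sym (begin
      sum (λ j → μ * (χ j - e j - ι j) * β⟨ j ⟩)
        ≈⟨ sum-cong-≋ {n} (λ j → solve 5 (λ u a b c f → u :* (a :- b :- c) :* f := u :* (a :* f :- b :* f :- c :* f))
                                         refl μ (χ j) (e j) (ι j) β⟨ j ⟩) ⟩
      sum (λ j → μ * (χ j * β⟨ j ⟩ - e j * β⟨ j ⟩ - ι j * β⟨ j ⟩))
        ≈⟨ *-distribˡ-sum {n} μ (λ j → χ j * β⟨ j ⟩ - e j * β⟨ j ⟩ - ι j * β⟨ j ⟩) ⟨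
      μ * sum (λ j → χ j * β⟨ j ⟩ - e j * β⟨ j ⟩ - ι j * β⟨ j ⟩)
        ≈⟨ *-congˡ (trans (sum-sub {n} _ _) (+-congʳ (sum-sub {n} _ _))) ⟩
      μ * (sum (λ j → χ j * β⟨ j ⟩) - sum (λ j → e j * β⟨ j ⟩) - sum (λ j → ι j * β⟨ j ⟩))
        ≈⟨ *-congˡ (+-cong (+-cong (sum-zechVector (zechView i)) (-‿cong (sum-𝟙δ first β⟨_⟩))) (-‿cong (sum-𝟙δ i β⟨_⟩))) ⟩
      μ * (zechTerm (zechView i) - β⟨ first ⟩ - β⟨ i ⟩)
        ∎))
      where
      χ e ι : Fin n → Carrier
      χ = 𝟙 ∘ zechVector (zechView i)
      e = 𝟙 ∘ δ first
      ι = 𝟙 ∘ δ i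

    𝟙-inBaseField : ∀ b → InBaseField q (𝟙 b)
    𝟙-inBaseField true  = inBaseField-1#
    𝟙-inBaseField false = inBaseField-0#

    t-inBaseField : ∀ i j → InBaseField q (t i j)
    t-inBaseField i j = inBaseField-* (inBaseField-inverse (inBaseField-×1 (suc n)) M*μ≈1)
      (inBaseField-+ (inBaseField-+ (𝟙-inBaseField (zechVector (zechView i) j)) (inBaseField-‿ (𝟙-inBaseField (δ first j))))
                     (inBaseField-‿ (𝟙-inBaseField (δ i j))))

    W : ℕ
    W = nz (1# + 1#)

    rowCount : ∀ i → sumℕ (λ j → nz (t i j)) ℕ.+ bit (δ antipode i) ℕ.+ bit (δ first i) ℕ.* 2 ≡ 3 ℕ.+ bit (δ first i) ℕ.* W
    rowCount i = ≡.trans (≡.cong (λ r → r ℕ.+ bit (δ antipode i) ℕ.+ bit (δ first i) ℕ.* 2)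
                                  (sumℕ-cong λ j → ≡.trans (nz-*ˡ _ μ≉0) (nz-𝟙-𝟙-𝟙 (zechVector (zechView i) j) (δ first j) (δ i j))))
                         (tallyRow (zechView i))
      where
      tallyRow : (v : ZechView i) → sumℕ (λ j → tally W (zechVector v j) (δ first j) (δ i j))
                                      ℕ.+ bit (δ antipode i) ℕ.+ bit (δ first i) ℕ.* 2 ≡ 3 ℕ.+ bit (δ first i) ℕ.* W
      tallyRow (zech k eq) with first Fin.≟ i | antipode Fin.≟ i
      ... | _       | yes a≡i = contradiction (≡.sym a≡i) (zech⇒≢antipode {i} {k} eq)
      ... | yes f≡i | no _    = ≡.trans (≡.cong (λ r → r ℕ.+ 0 ℕ.+ 2) row) (≡.cong suc (ℕ.+-comm (W ℕ.+ 0) 2))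
        where
        row : sumℕ (λ j → tally W (δ k j) (δ first j) (δ i j)) ≡ 1 ℕ.+ W
        row = ≡.subst (λ z → sumℕ (λ j → tally W (δ k j) (δ first j) (δ z j)) ≡ 1 ℕ.+ W) f≡i
                (sumℕ-tally-double W (zech≢first {i} {k} eq))
      ... | no f≢i  | no _    = ≡.cong (λ r → r ℕ.+ 0 ℕ.+ 0) (sumℕ-tally-distinct W (zech≢first {i} {k} eq) (zech≢self {i} {k} eq) f≢i)
      tallyRow (undefined eq) with first Fin.≟ i | antipode Fin.≟ i
      ... | _       | no a≢i  = contradiction (≡.sym (undefined⇒≡antipode {i} eq)) a≢i
      ... | yes f≡i | yes _   = ≡.trans (≡.cong (λ r → r ℕ.+ 1 ℕ.+ 2) row)
                                  (≡.trans (ℕ.+-assoc W 1 2) (≡.trans (ℕ.+-comm W 3) (≡.cong (3 ℕ.+_) (≡.sym (ℕ.+-identityʳ W)))))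
        where
        row : sumℕ (λ j → tally W false (δ first j) (δ i j)) ≡ W
        row = ≡.subst (λ z → sumℕ (λ j → tally W false (δ first j) (δ z j)) ≡ W) f≡i (sumℕ-tally-single W first)
      ... | no f≢i  | yes _   = ≡.cong (λ r → r ℕ.+ 1 ℕ.+ 0) (sumℕ-tally-pair W f≢i)

    open FieldDefs.WithDecEq L _≟_ using (nonzeroCount; NormalBasisComplexity)

    nonzeroCount-t : nonzeroCount t ≡ 3 ℕ.* n ℕ.+ W ℕ.∸ 3
    nonzeroCount-t = sumℕ-rows (λ i → sumℕ (λ j → nz (t i j))) antipode first W rowCount

    W-even : 2 ∣ q → W ≡ 0
    W-even 2∣q = ≡.trans (nz-cong (2∣q⇒1+1≈0 2∣q)) nz-0#

    W-odd : ¬ 2 ∣ q → W ≡ 1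
    W-odd 2∤q with (1# + 1#) ≟ 0#
    ... | yes 1+1≈0 = contradiction 1+1≈0 (¬2∣q⇒1+1≉0 2∤q)
    ... | no  _     = ≡.refl

    complexity : ∀ {k} → 3 ℕ.* n ℕ.+ W ℕ.∸ 3 ≡ k → NormalBasisComplexity q n β k
    complexity eq = t , t-inBaseField , t-row , ≡.trans nonzeroCount-t eq

    complexity-even : 2 ∣ q → NormalBasisComplexity q n β (3 ℕ.* n ℕ.∸ 3)
    complexity-even 2∣q =
      complexity (≡.trans (≡.cong (λ w → 3 ℕ.* n ℕ.+ w ℕ.∸ 3) (W-even 2∣q)) (≡.cong (ℕ._∸ 3) (ℕ.+-identityʳ (3 ℕ.* n))))

    -- 3n + 1 ∸ 3 reduces to 3n ∸ 2 once the 1 is moved to the front.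
    complexity-odd : ¬ 2 ∣ q → NormalBasisComplexity q n β (3 ℕ.* n ℕ.∸ 2)
    complexity-odd 2∤q =
      complexity (≡.trans (≡.cong (λ w → 3 ℕ.* n ℕ.+ w ℕ.∸ 3) (W-odd 2∤q)) (≡.cong (ℕ._∸ 3) (ℕ.+-comm (3 ℕ.* n) 1)))

open import Data.Nat using (_≤_; _*_; _∸_; _^_)
open import Data.Product using (_×_)

theorem1 : ∀ {c ℓ : Level} (q n : ℕ) → IsPrimePower q → 1 ≤ n → Prime (suc n) →
    IsPrimitiveRootMod q (suc n) →
    (L : CommutativeRing c ℓ) → FieldDefs.IsField L → FieldDefs.HasCardinality L (q ^ n) →
    (_≟_ : Decidable (CommutativeRing._≈_ L)) →
    (α : CommutativeRing.Carrier L) →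
    CommutativeRing._≈_ L (FieldDefs._^#_ L α (suc n)) (CommutativeRing.1# L) →
    ¬ CommutativeRing._≈_ L α (CommutativeRing.1# L) →
    (β : CommutativeRing.Carrier L) → FieldDefs.IsDualNormalGenerator L q n α β →
    (2 ∣ q → FieldDefs.WithDecEq.NormalBasisComplexity L _≟_ q n β (3 * n ∸ 3)) ×
    (¬ 2 ∣ q → FieldDefs.WithDecEq.NormalBasisComplexity L _≟_ q n β (3 * n ∸ 2))
theorem1 q n q-primePower _ n+1-prime q-primitive L isField card _≟_ α α^[1+n]≈1 α≉1 β β-dual =
  complexity-even , complexity-odd
  where open DualBasis.MultiplicationTable L isField _≟_ n q n+1-prime q-primitive α α^[1+n]≈1 α≉1 β β-dual q-primePower card
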